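{- Let $q$ be a prime power and $m,n$ positive integers. For every monic irreducible polynomial $f\in\mathbb{F}_q[X]$ of degree $mn$ there exists an $(m,n)$-block companion matrix $T$ over $\mathbb{F}_q$ with $\det(XI_{mn}-T)=f$. Consequently, for every primitive polynomial $f\in\mathbb{F}_q[X]$ of degree $mn$ there exists an $(m,n)$-block companion Singer cycle $T$ over $\mathbb{F}_q$ with $\det(XI_{mn}-T)=f$.
   Context: An $(m,n)$-block companion matrix over $\mathbb{F}_q$ is a matrix $T\in M_{mn}(\mathbb{F}_q)$ which, viewed as an $n\times n$ array of $m\times m$ blocks, has blocks $I_m$ in positions $(i+1,i)$ for $i=1,\dots,n-1$, arbitrary blocks $C_0,\dots,C_{n-1}\in M_m(\mathbb{F}_q)$ in the last block column, and zero blocks elsewhere. An $(m,n)$-block companion Singer cycle is such a matrix that is nonsingular and has order $q^{mn}-1$ in $GL_{mn}(\mathbb{F}_q)$. A polynomial of degree $d\ge1$ in $\mathbb{F}_q[X]$ is primitive if it is the minimal polynomial over $\mathbb{F}_q$ of a generator of $\mathbb{F}_{q^d}^*$. -}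

module Defs where

open import Level using (Level; _⊔_) renaming (suc to lsuc)
open import Data.Nat as ℕ using (ℕ; zero; suc; _∸_; _≤_; _<_; _^_)
open import Data.Nat.Primality using (Prime)
open import Data.Fin as Fin using (Fin; toℕ; combine; remQuot; punchIn)
open import Data.Bool using (if_then_else_; _∧_)
open import Data.Product using (Σ; _×_; _,_)
open import Data.Sum using (_⊎_)
open import Relation.Nullary using (¬_; does)
open import Relation.Binary.PropositionalEquality using (_≡_)
open import Algebra.Bundles using (CommutativeRing)
open import Algebra.Bundles.Raw using (RawRing)

IsPrimePower : ℕ → Set
IsPrimePower q = Σ ℕ λ p → Σ ℕ λ k → Prime p × 1 ≤ k × q ≡ p ^ k

module RawOps {c ℓ} (R : RawRing c ℓ) where
  open RawRing R

  Σ-fin : ∀ n → (Fin n → Carrier) → Carrier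
  Σ-fin zero    f = 0#
  Σ-fin (suc n) f = f Fin.zero + Σ-fin n (λ i → f (Fin.suc i))

  altSign : ℕ → Carrier → Carrier
  altSign zero    x = x
  altSign (suc j) x = - altSign j x

  det : ∀ n → (Fin n → Fin n → Carrier) → Carrier
  det zero    M = 1#
  det (suc n) M = Σ-fin (suc n) λ j →
    altSign (toℕ j) (M Fin.zero j * det n (λ r s → M (Fin.suc r) (punchIn j s)))

record Field c ℓ : Set (lsuc (c ⊔ ℓ)) where
  field
    commutativeRing : CommutativeRing c ℓ
  open CommutativeRing commutativeRing public
  field
    1≉0     : ¬ (1# ≈ 0#)
    inverse : ∀ x → ¬ (x ≈ 0#) → Σ Carrier λ y → x * y ≈ 1#

HasSize : ∀ {c ℓ} → Field c ℓ → ℕ → Set (c ⊔ ℓ)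
HasSize F q = Σ (Fin q → Carrier) λ e →
                (∀ x → Σ (Fin q) λ i → e i ≈ x) × (∀ i j → e i ≈ e j → i ≡ j)
  where open Field F

record FieldHom {c ℓ} (F K : Field c ℓ) : Set (c ⊔ ℓ) where
  private
    module F = Field F
    module K = Field K
  field
    ι      : F.Carrier → K.Carrier
    ι-cong : ∀ {x y} → x F.≈ y → ι x K.≈ ι y
    ι-+    : ∀ x y → ι (x F.+ y) K.≈ ι x K.+ ι y
    ι-*    : ∀ x y → ι (x F.* y) K.≈ ι x K.* ι y
    ι-1    : ι F.1# K.≈ K.1#

-- Polynomials over a field F: coefficient sequences ℕ → F
-- (coefficient of X^k at k); equality is coefficientwise.

module Over {c ℓ} (F : Field c ℓ) where
  open Field F
  open RawOps rawRing using (Σ-fin) renaming (det to detF)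

  Pol : Set c
  Pol = ℕ → Carrier

  _≈ₚ_ : Pol → Pol → Set ℓ
  f ≈ₚ g = ∀ k → f k ≈ g k

  constₚ : Carrier → Pol
  constₚ a zero    = a
  constₚ a (suc k) = 0#

  0ₚ 1ₚ Xₚ : Pol
  0ₚ = constₚ 0#
  1ₚ = constₚ 1#
  Xₚ zero          = 0#
  Xₚ (suc zero)    = 1#
  Xₚ (suc (suc k)) = 0#

  _+ₚ_ : Pol → Pol → Pol
  (f +ₚ g) k = f k + g k

  -ₚ_ : Pol → Pol
  (-ₚ f) k = - f k

  _*ₚ_ : Pol → Pol → Pol
  (f *ₚ g) k = Σ-fin (suc k) λ i → f (toℕ i) * g (k ∸ toℕ i)

  polyRawRing : RawRing c ℓ
  polyRawRing = record
    { Carrier = Pol ; _≈_ = _≈ₚ_ ; _+_ = _+ₚ_ ; _*_ = _*ₚ_ ; -_ = -ₚ_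
    ; 0# = 0ₚ ; 1# = 1ₚ }

  HasDegree : ℕ → Pol → Set ℓ
  HasDegree d f = ¬ (f d ≈ 0#) × (∀ k → d < k → f k ≈ 0#)

  Monic : ℕ → Pol → Set ℓ
  Monic d f = (f d ≈ 1#) × (∀ k → d < k → f k ≈ 0#)

  Irreducible : Pol → Set (c ⊔ ℓ)
  Irreducible f = Σ ℕ λ d → HasDegree d f × 1 ≤ d ×
    (∀ g h dg dh → HasDegree dg g → HasDegree dh h → f ≈ₚ (g *ₚ h) →
       dg ≡ 0 ⊎ dh ≡ 0)

  Mat : ℕ → Set c
  Mat N = Fin N → Fin N → Carrier

  _≈ₘ_ : ∀ {N} → Mat N → Mat N → Set ℓ
  A ≈ₘ B = ∀ i j → A i j ≈ B i j

  Iₘ : ∀ {N} → Mat N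
  Iₘ i j = if does (i Fin.≟ j) then 1# else 0#

  _*ₘ_ : ∀ {N} → Mat N → Mat N → Mat N
  _*ₘ_ {N} A B i j = Σ-fin N λ k → A i k * B k j

  _^ₘ_ : ∀ {N} → Mat N → ℕ → Mat N
  A ^ₘ zero  = Iₘ
  A ^ₘ suc k = A *ₘ (A ^ₘ k)

  Nonsingular : ∀ {N} → Mat N → Set ℓ
  Nonsingular {N} T = ¬ (detF N T ≈ 0#)

  HasOrder : ∀ {N} → Mat N → ℕ → Set ℓ
  HasOrder T ord = ((T ^ₘ ord) ≈ₘ Iₘ) × (∀ k → 1 ≤ k → k < ord → ¬ ((T ^ₘ k) ≈ₘ Iₘ))

  charPoly : ∀ {N} → Mat N → Pol
  charPoly {N} T = RawOps.det polyRawRing N λ i j →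
    (if does (i Fin.≟ j) then Xₚ else 0ₚ) +ₚ (-ₚ constₚ (T i j))

  -- Index of Fin (n * m) = combine i a (block i : Fin n, position a : Fin m),
  -- i.e. the k-th row is row a of block row i with k = i*m + a.
  blockCompanion : ∀ m n → (Fin n → Fin m → Fin m → Carrier) → Mat (n ℕ.* m)
  blockCompanion m n C k l = entry (remQuot {n} m k) (remQuot {n} m l)
    where
      entry : Fin n × Fin m → Fin n × Fin m → Carrier
      entry (i , a) (j , b) =
        if does (toℕ j ℕ.≟ n ∸ 1) then C i a b
        else if does (toℕ i ℕ.≟ suc (toℕ j)) ∧ does (a Fin.≟ b) then 1#
        else 0#

  IsBlockCompanion : ∀ m n → Mat (n ℕ.* m) → Set (c ⊔ ℓ)
  IsBlockCompanion m n T =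
    Σ (Fin n → Fin m → Fin m → Carrier) λ C → T ≈ₘ blockCompanion m n C

  IsBlockCompanionSinger : ℕ → ∀ m n → Mat (n ℕ.* m) → Set (c ⊔ ℓ)
  IsBlockCompanionSinger q m n T =
    IsBlockCompanion m n T × Nonsingular T × HasOrder T (q ^ (m ℕ.* n) ∸ 1)

  module _ (K : Field c ℓ) (φ : FieldHom F K) where
    private module K = Field K
    open FieldHom φ

    powK : K.Carrier → ℕ → K.Carrier
    powK α zero    = K.1#
    powK α (suc k) = α K.* powK α k

    evalUpTo : ℕ → Pol → K.Carrier → K.Carrier
    evalUpTo d f α = RawOps.Σ-fin K.rawRing (suc d) λ i → ι (f (toℕ i)) K.* powK α (toℕ i)

  -- f (of degree d) is primitive over F = F_q: it is the minimal polynomial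
  -- over F of a generator α of the multiplicative group of an extension
  -- field K of F with q^d elements.
  IsPrimitive : ℕ → ℕ → Pol → Set (lsuc (c ⊔ ℓ))
  IsPrimitive q d f = 1 ≤ d × Σ (Field c ℓ) λ K → Σ (FieldHom F K) λ φ →
    HasSize K (q ^ d) × Σ (Field.Carrier K) λ α →
      (¬ (Field._≈_ K α (Field.0# K))) ×
      (∀ β → ¬ (Field._≈_ K β (Field.0# K)) → Σ ℕ λ k → Field._≈_ K β (powK K φ α k)) ×
      Monic d f × Field._≈_ K (evalUpTo K φ d f α) (Field.0# K) ×
      (∀ g dg → HasDegree dg g → Field._≈_ K (evalUpTo K φ dg g α) (Field.0# K) → d ≤ dg)

module Submission where

-- Part 1: let C be the companion matrix of a monic f of degree N, so that
-- det(X·I − C) = f.  Reading the index i·m + a of an (m,n)-block matrix as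
-- row a of block i, the permutation σ(i·m + a) = a·n + i conjugates C into
-- an (m,n)-block companion matrix T = C ∘ (σ × σ); the determinant is
-- invariant under such conjugation, so det(X·I − T) = f.
-- Part 2: if f is the minimal polynomial of a generator α of K^*, where
-- |K| = q^(mn), then Φ v = Σ_k v_k α^(σ k) : F^N → K is injective (by the
-- minimality of f) and Φ(T v) = α·Φ v; so T^k = I iff α^k = 1, T has order
-- q^(mn) − 1, and det T = ±f(0) ≠ 0.

open import Algebra.Bundles using (CommutativeRing)
open import Algebra.Structures using (IsCommutativeRing)
open import Data.Nat as ℕ using (ℕ; zero; suc; _∸_)
import Data.Nat.Properties as ℕP
open import Data.Fin as Fin
  using (Fin; zero; suc; toℕ; fromℕ; fromℕ<; inject₁; punchIn; punchOut; combine; remQuot; cast)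
import Data.Fin.Properties as FinP
open import Data.Fin.Permutation as Perm using (Permutation′; permutation; _⟨$⟩ʳ_)
open import Data.Bool using (true; false; if_then_else_; _∧_)
open import Data.Product using (Σ; _,_; proj₁; proj₂; _×_)
open import Data.Empty using (⊥; ⊥-elim)
open import Relation.Nullary using (¬_; Dec; yes; no; does)
open import Relation.Binary.PropositionalEquality as P using (_≡_; _≢_)
open import Relation.Binary.Structures using (IsEquivalence)
open import Function using (_∘_)
open import Defs

if-yes : ∀ {a p} {A : Set a} {Q : Set p} (d : Dec Q) {x y : A} → Q → (if does d then x else y) ≡ x
if-yes (yes _) q = P.refl
if-yes (no ¬q) q = ⊥-elim (¬q q)

if-no : ∀ {a p} {A : Set a} {Q : Set p} (d : Dec Q) {x y : A} → ¬ Q → (if does d then x else y) ≡ y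
if-no (yes q) ¬q = ⊥-elim (¬q q)
if-no (no _) ¬q = P.refl

does-⇔ : ∀ {p q} {Q₁ : Set p} {Q₂ : Set q} (d₁ : Dec Q₁) (d₂ : Dec Q₂) →
  (Q₁ → Q₂) → (Q₂ → Q₁) → does d₁ ≡ does d₂
does-⇔ (yes a) (yes b) f g = P.refl
does-⇔ (yes a) (no ¬b) f g = ⊥-elim (¬b (f a))
does-⇔ (no ¬a) (yes b) f g = ⊥-elim (¬a (g b))
does-⇔ (no ¬a) (no ¬b) f g = P.refl

does-⇔-∧ : ∀ {p q r} {Q : Set p} {Q₁ : Set q} {Q₂ : Set r} (d : Dec Q) (d₁ : Dec Q₁) (d₂ : Dec Q₂) →
  (Q → Q₁ × Q₂) → (Q₁ → Q₂ → Q) → does d ≡ (does d₁ ∧ does d₂)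
does-⇔-∧ (yes q) (yes a) (yes b) f g = P.refl
does-⇔-∧ (yes q) (yes a) (no ¬b) f g = ⊥-elim (¬b (proj₂ (f q)))
does-⇔-∧ (yes q) (no ¬a) d₂ f g = ⊥-elim (¬a (proj₁ (f q)))
does-⇔-∧ (no ¬q) (yes a) (yes b) f g = ⊥-elim (¬q (g a b))
does-⇔-∧ (no ¬q) (yes a) (no ¬b) f g = P.refl
does-⇔-∧ (no ¬q) (no ¬a) d₂ f g = P.refl

largestWitness : ∀ {p} N (Pr : ℕ → Set p) → (∀ t → Dec (Pr t)) → ∀ i → i ℕ.< N → Pr i →
  Σ ℕ λ t → t ℕ.< N × Pr t × (∀ t' → t ℕ.< t' → t' ℕ.< N → ¬ Pr t')
largestWitness zero Pr dec i () p
largestWitness (suc N) Pr dec i i<N p with dec N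
... | yes pN = N , ℕP.n<1+n N , pN , (λ t' N<t' t'≤N _ → ℕP.<-irrefl P.refl (ℕP.<-≤-trans N<t' (ℕP.≤-pred t'≤N)))
... | no ¬pN with i ℕ.≟ N
... | yes P.refl = ⊥-elim (¬pN p)
... | no i≢N with largestWitness N Pr dec i (ℕP.≤∧≢⇒< (ℕP.≤-pred i<N) i≢N) p
... | t , t<N , pt , above = t , ℕP.<-trans t<N (ℕP.n<1+n N) , pt , above′
  where
  above′ : ∀ t' → t ℕ.< t' → t' ℕ.< suc N → ¬ Pr t'
  above′ t' t<t' t'≤N pt' with t' ℕ.≟ N
  ... | yes P.refl = ¬pN pt'
  ... | no t'≢N = above t' t<t' (ℕP.≤∧≢⇒< (ℕP.≤-pred t'≤N) t'≢N) pt'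

-- Permutations of Fin n as words in adjacent transpositions.

adjSwap : ∀ {n} → Fin n → Fin (suc n) → Fin (suc n)
adjSwap zero zero = suc zero
adjSwap zero (suc zero) = zero
adjSwap zero (suc (suc x)) = suc (suc x)
adjSwap (suc k) zero = zero
adjSwap (suc k) (suc x) = suc (adjSwap k x)

adjSwap-left : ∀ {n} (k : Fin n) → adjSwap k (inject₁ k) ≡ suc k
adjSwap-left zero = P.refl
adjSwap-left (suc k) = P.cong suc (adjSwap-left k)

adjSwap-right : ∀ {n} (k : Fin n) → adjSwap k (suc k) ≡ inject₁ k
adjSwap-right zero = P.refl
adjSwap-right (suc k) = P.cong suc (adjSwap-right k)

adjSwap-punchIn-left : ∀ {n} (k : Fin n) s → adjSwap k (punchIn (inject₁ k) s) ≡ punchIn (suc k) s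
adjSwap-punchIn-left zero zero = P.refl
adjSwap-punchIn-left zero (suc s) = P.refl
adjSwap-punchIn-left (suc k) zero = P.refl
adjSwap-punchIn-left (suc k) (suc s) = P.cong suc (adjSwap-punchIn-left k s)

adjSwap-punchIn-right : ∀ {n} (k : Fin n) s → adjSwap k (punchIn (suc k) s) ≡ punchIn (inject₁ k) s
adjSwap-punchIn-right zero zero = P.refl
adjSwap-punchIn-right zero (suc s) = P.refl
adjSwap-punchIn-right (suc k) zero = P.refl
adjSwap-punchIn-right (suc k) (suc s) = P.cong suc (adjSwap-punchIn-right k s)

adjSwap-other : ∀ {n} (k : Fin (suc n)) j → j ≢ inject₁ k → j ≢ suc k → adjSwap k j ≡ j
adjSwap-other zero zero p q = ⊥-elim (p P.refl)
adjSwap-other zero (suc zero) p q = ⊥-elim (q P.refl)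
adjSwap-other zero (suc (suc j)) p q = P.refl
adjSwap-other (suc k) zero p q = P.refl
adjSwap-other {suc n} (suc k) (suc j) p q =
  P.cong suc (adjSwap-other k j (p ∘ P.cong suc) (q ∘ P.cong suc))

adjSwap-punchIn-other : ∀ {n} (k : Fin (suc n)) j → j ≢ inject₁ k → j ≢ suc k →
  Σ (Fin n) λ k' → ∀ s → adjSwap k (punchIn j s) ≡ punchIn j (adjSwap k' s)
adjSwap-punchIn-other zero zero p q = ⊥-elim (p P.refl)
adjSwap-punchIn-other zero (suc zero) p q = ⊥-elim (q P.refl)
adjSwap-punchIn-other {suc n} zero (suc (suc j)) p q = zero , commute
  where
  commute : ∀ s → adjSwap zero (punchIn (suc (suc j)) s) ≡ punchIn (suc (suc j)) (adjSwap zero s)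
  commute zero = P.refl
  commute (suc zero) = P.refl
  commute (suc (suc s)) = P.refl
adjSwap-punchIn-other (suc k) zero p q = k , λ s → P.refl
adjSwap-punchIn-other {suc n} (suc k) (suc j) p q
  with adjSwap-punchIn-other k j (p ∘ P.cong suc) (q ∘ P.cong suc)
... | k' , e = suc k' , commute
  where
  commute : ∀ s → adjSwap (suc k) (punchIn (suc j) s) ≡ punchIn (suc j) (adjSwap (suc k') s)
  commute zero = P.refl
  commute (suc s) = P.cong suc (e s)

punchIn-punchOut-sym : ∀ {n} (a b : Fin (suc (suc n))) (a≢b : a ≢ b) (b≢a : b ≢ a) s →
  punchIn a (punchIn (punchOut a≢b) s) ≡ punchIn b (punchIn (punchOut b≢a) s)
punchIn-punchOut-sym zero zero a≢b b≢a s = ⊥-elim (a≢b P.refl)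
punchIn-punchOut-sym zero (suc b) a≢b b≢a s = P.refl
punchIn-punchOut-sym (suc a) zero a≢b b≢a s = P.refl
punchIn-punchOut-sym {suc n} (suc a) (suc b) a≢b b≢a zero = P.refl
punchIn-punchOut-sym {suc n} (suc a) (suc b) a≢b b≢a (suc s) =
  P.cong suc (punchIn-punchOut-sym a b (a≢b ∘ P.cong suc) (b≢a ∘ P.cong suc) s)

data AdjWord : ∀ {n} → (Fin n → Fin n) → Set where
  idʷ   : ∀ {n} → AdjWord {n} (λ x → x)
  swapʷ : ∀ {n} (k : Fin n) → AdjWord {suc n} (adjSwap k)
  _∘ʷ_  : ∀ {n} {g h : Fin n → Fin n} → AdjWord g → AdjWord h → AdjWord (λ x → g (h x))
  extʷ  : ∀ {n} {g h : Fin n → Fin n} → AdjWord g → (∀ x → g x ≡ h x) → AdjWord h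

liftFix : ∀ {n} → (Fin n → Fin n) → Fin (suc n) → Fin (suc n)
liftFix g zero = zero
liftFix g (suc x) = suc (g x)

liftFix-word : ∀ {n} {g : Fin n → Fin n} → AdjWord g → AdjWord (liftFix g)
liftFix-word idʷ = extʷ idʷ (λ { zero → P.refl ; (suc x) → P.refl })
liftFix-word (swapʷ k) = extʷ (swapʷ (suc k)) (λ { zero → P.refl ; (suc x) → P.refl })
liftFix-word (a ∘ʷ b) = extʷ (liftFix-word a ∘ʷ liftFix-word b) (λ { zero → P.refl ; (suc x) → P.refl })
liftFix-word (extʷ a e) = extʷ (liftFix-word a) (λ { zero → P.refl ; (suc x) → P.cong suc (e x) })

cycleTo : ∀ {n} → Fin (suc n) → Fin (suc n) → Fin (suc n)
cycleTo j zero = j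
cycleTo j (suc x) = punchIn j x

cycleTo-word : ∀ {n} (j : Fin (suc n)) → AdjWord (cycleTo j)
cycleTo-word zero = extʷ idʷ (λ { zero → P.refl ; (suc x) → P.refl })
cycleTo-word {suc n} (suc j) = extʷ (liftFix-word (cycleTo-word j) ∘ʷ swapʷ zero) agree
  where
  agree : ∀ x → liftFix (cycleTo j) (adjSwap zero x) ≡ cycleTo (suc j) x
  agree zero = P.refl
  agree (suc zero) = P.refl
  agree (suc (suc x)) = P.refl

-- Every permutation is a word in adjacent transpositions: π = cycleTo (π 0) ∘ lift (π restricted).
permutation-word : ∀ n (π : Permutation′ n) → AdjWord (π ⟨$⟩ʳ_)
permutation-word zero π = extʷ idʷ (λ ())
permutation-word (suc n) π =
  extʷ (cycleTo-word (π ⟨$⟩ʳ zero) ∘ʷ liftFix-word (permutation-word n (Perm.remove zero π))) agree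
  where
  agree : ∀ x → cycleTo (π ⟨$⟩ʳ zero) (liftFix (Perm.remove zero π ⟨$⟩ʳ_) x) ≡ π ⟨$⟩ʳ x
  agree zero = P.refl
  agree (suc y) = P.sym (Perm.punchIn-permute π zero y)

module RingSums {c ℓ} (R : CommutativeRing c ℓ) where
  open CommutativeRing R hiding (zero)
  open RawOps rawRing public
  open import Algebra.Properties.Ring ring public
    using (-‿involutive; -‿distribˡ-*; -‿distribʳ-*; -0#≈0#; -‿+-comm; +-inverseˡ-unique)
  open import Relation.Binary.Reasoning.Setoid setoid
  import Algebra.Properties.CommutativeMonoid.Sum +-commutativeMonoid as Sum
  open import Data.Vec.Functional using (removeAt)

  -- Σ-fin is the library's sum, so the library's rearrangement lemmas apply.
  Σ-fin≡sum : ∀ n f → Σ-fin n f ≡ Sum.sum f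
  Σ-fin≡sum zero f = P.refl
  Σ-fin≡sum (suc n) f = P.cong (f zero +_) (Σ-fin≡sum n (λ i → f (suc i)))

  Σ-cong : ∀ n {f g : Fin n → Carrier} → (∀ i → f i ≈ g i) → Σ-fin n f ≈ Σ-fin n g
  Σ-cong zero e = refl
  Σ-cong (suc n) e = +-cong (e zero) (Σ-cong n (λ i → e (suc i)))

  Σ-zero : ∀ n {f : Fin n → Carrier} → (∀ i → f i ≈ 0#) → Σ-fin n f ≈ 0#
  Σ-zero zero e = refl
  Σ-zero (suc n) e = trans (+-cong (e zero) (Σ-zero n (λ i → e (suc i)))) (+-identityˡ 0#)

  Σ-+ : ∀ n (f g : Fin n → Carrier) → Σ-fin n (λ i → f i + g i) ≈ Σ-fin n f + Σ-fin n g
  Σ-+ n f g = begin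
    Σ-fin n (λ i → f i + g i) ≡⟨ Σ-fin≡sum n _ ⟩
    Sum.sum (λ i → f i + g i) ≈⟨ Sum.∑-distrib-+ f g ⟩
    Sum.sum f + Sum.sum g     ≡⟨ P.sym (P.cong₂ _+_ (Σ-fin≡sum n f) (Σ-fin≡sum n g)) ⟩
    Σ-fin n f + Σ-fin n g     ∎

  Σ-*ˡ : ∀ n x (f : Fin n → Carrier) → x * Σ-fin n f ≈ Σ-fin n (λ i → x * f i)
  Σ-*ˡ zero x f = zeroʳ x
  Σ-*ˡ (suc n) x f = trans (distribˡ x _ _) (+-cong refl (Σ-*ˡ n x (λ i → f (suc i))))

  Σ-*ʳ : ∀ n x (f : Fin n → Carrier) → Σ-fin n f * x ≈ Σ-fin n (λ i → f i * x)
  Σ-*ʳ zero x f = zeroˡ x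
  Σ-*ʳ (suc n) x f = trans (distribʳ x _ _) (+-cong refl (Σ-*ʳ n x (λ i → f (suc i))))

  Σ-neg : ∀ n (f : Fin n → Carrier) → - Σ-fin n f ≈ Σ-fin n (λ i → - f i)
  Σ-neg zero f = -0#≈0#
  Σ-neg (suc n) f = trans (sym (-‿+-comm _ _)) (+-cong refl (Σ-neg n (λ i → f (suc i))))

  Σ-comm : ∀ m n (f : Fin m → Fin n → Carrier) →
    Σ-fin m (λ i → Σ-fin n (f i)) ≈ Σ-fin n (λ j → Σ-fin m (λ i → f i j))
  Σ-comm m n f = begin
    Σ-fin m (λ i → Σ-fin n (f i))             ≡⟨ Σ-fin≡sum m _ ⟩
    Sum.sum (λ i → Σ-fin n (f i))             ≡⟨ Sum.sum-cong-≗ (λ i → Σ-fin≡sum n (f i)) ⟩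
    Sum.sum (λ i → Sum.sum (f i))             ≈⟨ Sum.∑-comm f ⟩
    Sum.sum (λ j → Sum.sum (λ i → f i j))     ≡⟨ P.sym (Sum.sum-cong-≗ (λ j → Σ-fin≡sum m (λ i → f i j))) ⟩
    Sum.sum (λ j → Σ-fin m (λ i → f i j))     ≡⟨ P.sym (Σ-fin≡sum n _) ⟩
    Σ-fin n (λ j → Σ-fin m (λ i → f i j))     ∎

  Σ-permute : ∀ n (f : Fin n → Carrier) (π : Permutation′ n) →
    Σ-fin n f ≈ Σ-fin n (λ i → f (π ⟨$⟩ʳ i))
  Σ-permute n f π = begin
    Σ-fin n f                       ≡⟨ Σ-fin≡sum n f ⟩
    Sum.sum f                       ≈⟨ Sum.∑-permute f π ⟩
    Sum.sum (λ i → f (π ⟨$⟩ʳ i))    ≡⟨ P.sym (Σ-fin≡sum n _) ⟩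
    Σ-fin n (λ i → f (π ⟨$⟩ʳ i))    ∎

  Σ-remove : ∀ n (f : Fin (suc n) → Carrier) i →
    Σ-fin (suc n) f ≈ f i + Σ-fin n (λ j → f (punchIn i j))
  Σ-remove n f i = begin
    Σ-fin (suc n) f                          ≡⟨ Σ-fin≡sum (suc n) f ⟩
    Sum.sum f                                ≈⟨ Sum.sum-remove f ⟩
    f i + Sum.sum (removeAt f i)             ≡⟨ P.cong (f i +_) (P.sym (Σ-fin≡sum n _)) ⟩
    f i + Σ-fin n (λ j → f (punchIn i j))    ∎

  Σ-single : ∀ n (f : Fin (suc n) → Carrier) i → (∀ j → j ≢ i → f j ≈ 0#) → Σ-fin (suc n) f ≈ f i
  Σ-single n f i others = trans (Σ-remove n f i)
    (trans (+-cong refl (Σ-zero n (λ j → others (punchIn i j) (FinP.punchInᵢ≢i i j)))) (+-identityʳ _))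

  Σ-adjSwap : ∀ n (k : Fin n) (f : Fin (suc n) → Carrier) →
    Σ-fin (suc n) (λ i → f (adjSwap k i)) ≈ Σ-fin (suc n) f
  Σ-adjSwap (suc n) zero f = begin
    f (suc zero) + (f zero + rest)   ≈⟨ sym (+-assoc _ _ _) ⟩
    (f (suc zero) + f zero) + rest   ≈⟨ +-cong (+-comm _ _) refl ⟩
    (f zero + f (suc zero)) + rest   ≈⟨ +-assoc _ _ _ ⟩
    f zero + (f (suc zero) + rest)   ∎
    where
    rest : Carrier
    rest = Σ-fin n (λ i → f (suc (suc i)))
  Σ-adjSwap (suc n) (suc k) f = +-cong refl (Σ-adjSwap n k (λ i → f (suc i)))

  Σℕ : ℕ → (ℕ → Carrier) → Carrier
  Σℕ zero f = 0#
  Σℕ (suc n) f = f 0 + Σℕ n (λ i → f (suc i))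

  Σ-fin≡Σℕ : ∀ n (f : ℕ → Carrier) → Σ-fin n (λ i → f (toℕ i)) ≡ Σℕ n f
  Σ-fin≡Σℕ zero f = P.refl
  Σ-fin≡Σℕ (suc n) f = P.cong (f 0 +_) (Σ-fin≡Σℕ n (λ i → f (suc i)))

  Σℕ-cong : ∀ n {f g : ℕ → Carrier} → (∀ i → i ℕ.< n → f i ≈ g i) → Σℕ n f ≈ Σℕ n g
  Σℕ-cong zero e = refl
  Σℕ-cong (suc n) e = +-cong (e 0 (ℕ.s≤s ℕ.z≤n)) (Σℕ-cong n (λ i i<n → e (suc i) (ℕ.s≤s i<n)))

  Σℕ-+ : ∀ n (f g : ℕ → Carrier) → Σℕ n (λ i → f i + g i) ≈ Σℕ n f + Σℕ n g
  Σℕ-+ zero f g = sym (+-identityˡ 0#)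
  Σℕ-+ (suc n) f g = trans (+-cong refl (Σℕ-+ n (λ i → f (suc i)) (λ i → g (suc i)))) (interchange _ _ _ _)
    where
    interchange : ∀ a b c d → (a + b) + (c + d) ≈ (a + c) + (b + d)
    interchange a b c d = begin
      (a + b) + (c + d) ≈⟨ +-assoc a b (c + d) ⟩
      a + (b + (c + d)) ≈⟨ +-cong refl (sym (+-assoc b c d)) ⟩
      a + ((b + c) + d) ≈⟨ +-cong refl (+-cong (+-comm b c) refl) ⟩
      a + ((c + b) + d) ≈⟨ +-cong refl (+-assoc c b d) ⟩
      a + (c + (b + d)) ≈⟨ sym (+-assoc a c (b + d)) ⟩
      (a + c) + (b + d) ∎

  Σℕ-*ˡ : ∀ n x (f : ℕ → Carrier) → x * Σℕ n f ≈ Σℕ n (λ i → x * f i)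
  Σℕ-*ˡ zero x f = zeroʳ x
  Σℕ-*ˡ (suc n) x f = trans (distribˡ x _ _) (+-cong refl (Σℕ-*ˡ n x (λ i → f (suc i))))

  Σℕ-*ʳ : ∀ n x (f : ℕ → Carrier) → Σℕ n f * x ≈ Σℕ n (λ i → f i * x)
  Σℕ-*ʳ zero x f = zeroˡ x
  Σℕ-*ʳ (suc n) x f = trans (distribʳ x _ _) (+-cong refl (Σℕ-*ʳ n x (λ i → f (suc i))))

  Σℕ-last : ∀ n (f : ℕ → Carrier) → Σℕ (suc n) f ≈ Σℕ n f + f n
  Σℕ-last zero f = trans (+-identityʳ _) (sym (+-identityˡ _))
  Σℕ-last (suc n) f = trans (+-cong refl (Σℕ-last n (λ i → f (suc i)))) (sym (+-assoc _ _ _))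

  Σℕ-reverse : ∀ n (h : ℕ → Carrier) → Σℕ n h ≈ Σℕ n (λ i → h (n ∸ suc i))
  Σℕ-reverse zero h = refl
  Σℕ-reverse (suc n) h = begin
    h 0 + Σℕ n (λ i → h (suc i))                ≈⟨ +-cong refl (Σℕ-reverse n (λ i → h (suc i))) ⟩
    h 0 + Σℕ n (λ i → h (suc (n ∸ suc i)))      ≈⟨ +-comm _ _ ⟩
    Σℕ n (λ i → h (suc (n ∸ suc i))) + h 0      ≈⟨ +-cong (Σℕ-cong n (λ i i<n → reflexive (P.cong h (P.sym (ℕP.+-∸-assoc 1 i<n)))))
                                                          (reflexive (P.cong h (P.sym (ℕP.n∸n≡0 n)))) ⟩
    Σℕ n (λ i → h (n ∸ i)) + h (n ∸ n)          ≈⟨ sym (Σℕ-last n (λ i → h (n ∸ i))) ⟩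
    Σℕ (suc n) (λ i → h (n ∸ i))                ∎

  Σℕ-triangle : ∀ k (B : ℕ → ℕ → Carrier) →
    Σℕ (suc k) (λ i → Σℕ (suc i) (B i)) ≈ Σℕ (suc k) (λ j → Σℕ (suc (k ∸ j)) (λ l → B (j ℕ.+ l) j))
  Σℕ-triangle zero B = refl
  Σℕ-triangle (suc k) B = begin
    Σℕ (suc (suc k)) (λ i → Σℕ (suc i) (B i))                           ≈⟨ Σℕ-last (suc k) (λ i → Σℕ (suc i) (B i)) ⟩
    Σℕ (suc k) (λ i → Σℕ (suc i) (B i)) + Σℕ (suc (suc k)) (B (suc k))  ≈⟨ +-cong (Σℕ-triangle k B) (Σℕ-last (suc k) (B (suc k))) ⟩
    Σℕ (suc k) rows + (Σℕ (suc k) (B (suc k)) + B (suc k) (suc k))     ≈⟨ sym (+-assoc _ _ _) ⟩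
    (Σℕ (suc k) rows + Σℕ (suc k) (B (suc k))) + B (suc k) (suc k)     ≈⟨ +-cong (sym (Σℕ-+ (suc k) rows (B (suc k)))) (sym lastRow) ⟩
    Σℕ (suc k) (λ j → rows j + B (suc k) j) + rows′ (suc k)              ≈⟨ +-cong (Σℕ-cong (suc k) extendRow) refl ⟩
    Σℕ (suc k) rows′ + rows′ (suc k)                                     ≈⟨ sym (Σℕ-last (suc k) rows′) ⟩
    Σℕ (suc (suc k)) rows′                                               ∎
    where
    rows rows′ : ℕ → Carrier
    rows j = Σℕ (suc (k ∸ j)) (λ l → B (j ℕ.+ l) j)
    rows′ j = Σℕ (suc (suc k ∸ j)) (λ l → B (j ℕ.+ l) j)
    lastRow : rows′ (suc k) ≈ B (suc k) (suc k)
    lastRow = begin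
      Σℕ (suc (k ∸ k)) (λ l → B (suc k ℕ.+ l) (suc k))  ≡⟨ P.cong (λ t → Σℕ (suc t) (λ l → B (suc k ℕ.+ l) (suc k))) (ℕP.n∸n≡0 k) ⟩
      B (suc k ℕ.+ 0) (suc k) + 0#                        ≈⟨ +-identityʳ _ ⟩
      B (suc k ℕ.+ 0) (suc k)                             ≡⟨ P.cong (λ t → B t (suc k)) (ℕP.+-identityʳ (suc k)) ⟩
      B (suc k) (suc k)                                   ∎
    extendRow : ∀ j → j ℕ.< suc k → rows j + B (suc k) j ≈ rows′ j
    extendRow j (ℕ.s≤s j≤k) = begin
      rows j + B (suc k) j
        ≡⟨ P.cong (λ t → rows j + B t j) (P.trans (P.cong suc (P.sym (ℕP.m+[n∸m]≡n j≤k))) (P.sym (ℕP.+-suc j (k ∸ j)))) ⟩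
      rows j + B (j ℕ.+ suc (k ∸ j)) j
        ≈⟨ sym (Σℕ-last (suc (k ∸ j)) (λ l → B (j ℕ.+ l) j)) ⟩
      Σℕ (suc (suc (k ∸ j))) (λ l → B (j ℕ.+ l) j)
        ≡⟨ P.cong (λ t → Σℕ (suc t) (λ l → B (j ℕ.+ l) j)) (P.sym (ℕP.+-∸-assoc 1 j≤k)) ⟩
      rows′ j ∎

  Σℕ-extend : ∀ a j (G : ℕ → Carrier) → (∀ t → a ℕ.≤ t → t ℕ.< a ℕ.+ j → G t ≈ 0#) → Σℕ a G ≈ Σℕ (a ℕ.+ j) G
  Σℕ-extend a zero G h = reflexive (P.cong (λ t → Σℕ t G) (P.sym (ℕP.+-identityʳ a)))
  Σℕ-extend a (suc j) G h = begin
    Σℕ a G                     ≈⟨ Σℕ-extend a j G (λ t le lt → h t le (ℕP.<-trans lt (ℕP.+-monoʳ-< a (ℕP.n<1+n j)))) ⟩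
    Σℕ (a ℕ.+ j) G             ≈⟨ sym (+-identityʳ _) ⟩
    Σℕ (a ℕ.+ j) G + 0#        ≈⟨ +-cong refl (sym (h (a ℕ.+ j) (ℕP.m≤m+n a j) (ℕP.+-monoʳ-< a (ℕP.n<1+n j)))) ⟩
    Σℕ (a ℕ.+ j) G + G (a ℕ.+ j) ≈⟨ sym (Σℕ-last (a ℕ.+ j) G) ⟩
    Σℕ (suc (a ℕ.+ j)) G       ≡⟨ P.cong (λ t → Σℕ t G) (P.sym (ℕP.+-suc a j)) ⟩
    Σℕ (a ℕ.+ suc j) G         ∎

  alt-cong : ∀ j {x y} → x ≈ y → altSign j x ≈ altSign j y
  alt-cong zero e = e
  alt-cong (suc j) e = -‿cong (alt-cong j e)

  alt-≡ : ∀ {a b} x → a ≡ b → altSign a x ≈ altSign b x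
  alt-≡ x P.refl = refl

  alt-neg : ∀ j x → altSign j (- x) ≈ - altSign j x
  alt-neg zero x = refl
  alt-neg (suc j) x = -‿cong (alt-neg j x)

  neg-alt-neg : ∀ j x → - altSign j (- x) ≈ altSign j x
  neg-alt-neg j x = trans (-‿cong (alt-neg j x)) (-‿involutive _)

  alt-alt : ∀ j x → altSign j (altSign j x) ≈ x
  alt-alt zero x = refl
  alt-alt (suc j) x = trans (neg-alt-neg j (altSign j x)) (alt-alt j x)

  alt-comm : ∀ a b x → altSign a (altSign b x) ≈ altSign b (altSign a x)
  alt-comm zero b x = refl
  alt-comm (suc a) b x = trans (-‿cong (alt-comm a b x)) (sym (alt-neg b (altSign a x)))

  alt-*ˡ : ∀ j x y → altSign j (x * y) ≈ x * altSign j y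
  alt-*ˡ zero x y = refl
  alt-*ˡ (suc j) x y = trans (-‿cong (alt-*ˡ j x y)) (-‿distribʳ-* _ _)

  alt-0 : ∀ j → altSign j 0# ≈ 0#
  alt-0 zero = refl
  alt-0 (suc j) = trans (-‿cong (alt-0 j)) -0#≈0#

  alt-Σ : ∀ j n (f : Fin n → Carrier) → altSign j (Σ-fin n f) ≈ Σ-fin n (λ i → altSign j (f i))
  alt-Σ zero n f = refl
  alt-Σ (suc j) n f = trans (-‿cong (alt-Σ j n f)) (Σ-neg n _)

  alt-punchOut : ∀ {n} (a b : Fin (suc (suc n))) (a≢b : a ≢ b) (b≢a : b ≢ a) x →
    altSign (toℕ a) (altSign (toℕ (punchOut a≢b)) x) ≈ - altSign (toℕ b) (altSign (toℕ (punchOut b≢a)) x)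
  alt-punchOut zero zero a≢b b≢a x = ⊥-elim (a≢b P.refl)
  alt-punchOut zero (suc b) a≢b b≢a x = sym (-‿involutive _)
  alt-punchOut (suc a) zero a≢b b≢a x = refl
  alt-punchOut {zero} (suc zero) (suc zero) a≢b b≢a x = ⊥-elim (a≢b P.refl)
  alt-punchOut {suc n} (suc a) (suc b) a≢b b≢a x = begin
    - altSign (toℕ a) (- altSign (toℕ (punchOut a≢b′)) x)     ≈⟨ neg-alt-neg (toℕ a) _ ⟩
    altSign (toℕ a) (altSign (toℕ (punchOut a≢b′)) x)         ≈⟨ alt-punchOut a b _ _ x ⟩
    - altSign (toℕ b) (altSign (toℕ (punchOut b≢a′)) x)       ≈⟨ -‿cong (sym (neg-alt-neg (toℕ b) _)) ⟩
    - (- altSign (toℕ b) (- altSign (toℕ (punchOut b≢a′)) x)) ∎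
    where
    a≢b′ : a ≢ b
    a≢b′ = a≢b ∘ P.cong suc
    b≢a′ : b ≢ a
    b≢a′ = b≢a ∘ P.cong suc

module Determinant {c ℓ} (R : CommutativeRing c ℓ) where
  open CommutativeRing R hiding (zero)
  open RingSums R public
  open import Relation.Binary.Reasoning.Setoid setoid

  SqMat : ℕ → Set c
  SqMat n = Fin n → Fin n → Carrier

  minor : ∀ {n} → Fin (suc n) → SqMat (suc n) → SqMat n
  minor j M r s = M (suc r) (punchIn j s)

  det-cong : ∀ n {A B : SqMat n} → (∀ i j → A i j ≈ B i j) → det n A ≈ det n B
  det-cong zero e = refl
  det-cong (suc n) e = Σ-cong (suc n) λ j →
    alt-cong (toℕ j) (*-cong (e zero j) (det-cong n (λ r s → e (suc r) (punchIn j s))))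

  det-≡ : ∀ n {A B : SqMat n} → (∀ i j → A i j ≡ B i j) → det n A ≈ det n B
  det-≡ n e = det-cong n (λ i j → reflexive (e i j))

  laplaceTerm : ∀ {n} → SqMat (suc n) → Fin (suc n) → Carrier
  laplaceTerm {n} M j = altSign (toℕ j) (M zero j * det n (minor j M))

  laplaceTerm-zeroEntry : ∀ {n} (M : SqMat (suc n)) j → M zero j ≈ 0# → laplaceTerm M j ≈ 0#
  laplaceTerm-zeroEntry M j e = trans (alt-cong (toℕ j) (trans (*-cong e refl) (zeroˡ _))) (alt-0 (toℕ j))

  det-zeroColumn : ∀ n (M : SqMat (suc n)) → (∀ r → M r zero ≈ 0#) → det (suc n) M ≈ 0#
  det-zeroColumn zero M h = trans (+-identityʳ _) (laplaceTerm-zeroEntry M zero (h zero))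
  det-zeroColumn (suc n) M h =
    trans (+-cong (laplaceTerm-zeroEntry M zero (h zero)) (Σ-zero (suc n) minorVanishes)) (+-identityˡ _)
    where
    minorVanishes : ∀ j → laplaceTerm M (suc j) ≈ 0#
    minorVanishes j = trans (alt-cong (toℕ (suc j))
                               (trans (*-cong refl (det-zeroColumn n (minor (suc j) M) (λ r → h (suc r)))) (zeroʳ _)))
                            (alt-0 (toℕ (suc j)))

  mutual
    det-columnSwap : ∀ n (k : Fin (suc n)) (M : SqMat (suc (suc n))) →
      det (suc (suc n)) (λ i j → M i (adjSwap k j)) ≈ - det (suc (suc n)) M
    det-columnSwap n k M = begin
      Σ-fin (suc (suc n)) (laplaceTerm (λ i j → M i (adjSwap k j)))  ≈⟨ Σ-cong (suc (suc n)) (laplaceTerm-columnSwap n k M) ⟩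
      Σ-fin (suc (suc n)) (λ j → - laplaceTerm M (adjSwap k j))      ≈⟨ sym (Σ-neg (suc (suc n)) (λ j → laplaceTerm M (adjSwap k j))) ⟩
      - Σ-fin (suc (suc n)) (λ j → laplaceTerm M (adjSwap k j))      ≈⟨ -‿cong (Σ-adjSwap (suc n) k (laplaceTerm M)) ⟩
      - det (suc (suc n)) M                                          ∎

    -- Termwise: the terms of the columns k, k + 1 trade places (with the
    -- opposite sign), and every other term has two adjacent columns of its
    -- minor swapped, which negates it by induction on the size.
    laplaceTerm-columnSwap : ∀ n (k : Fin (suc n)) (M : SqMat (suc (suc n))) j →
      laplaceTerm (λ i j → M i (adjSwap k j)) j ≈ - laplaceTerm M (adjSwap k j)
    laplaceTerm-columnSwap n k M j with j Fin.≟ inject₁ k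
    ... | yes P.refl = begin
      altSign (toℕ (inject₁ k)) (M zero (adjSwap k (inject₁ k)) * det (suc n) (λ r s → M (suc r) (adjSwap k (punchIn (inject₁ k) s))))
        ≈⟨ alt-≡ _ (FinP.toℕ-inject₁ k) ⟩
      altSign (toℕ k) (M zero (adjSwap k (inject₁ k)) * det (suc n) (λ r s → M (suc r) (adjSwap k (punchIn (inject₁ k) s))))
        ≈⟨ alt-cong (toℕ k) (*-cong (reflexive (P.cong (M zero) (adjSwap-left k)))
                                    (det-≡ (suc n) (λ r s → P.cong (M (suc r)) (adjSwap-punchIn-left k s)))) ⟩
      altSign (toℕ k) (M zero (suc k) * det (suc n) (minor (suc k) M))
        ≈⟨ sym (-‿involutive _) ⟩
      - laplaceTerm M (suc k)
        ≡⟨ P.cong (λ t → - laplaceTerm M t) (P.sym (adjSwap-left k)) ⟩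
      - laplaceTerm M (adjSwap k (inject₁ k)) ∎
    ... | no j≢k with j Fin.≟ suc k
    ... | yes P.refl = begin
      - altSign (toℕ k) (M zero (adjSwap k (suc k)) * det (suc n) (λ r s → M (suc r) (adjSwap k (punchIn (suc k) s))))
        ≈⟨ -‿cong (alt-cong (toℕ k) (*-cong (reflexive (P.cong (M zero) (adjSwap-right k)))
                                            (det-≡ (suc n) (λ r s → P.cong (M (suc r)) (adjSwap-punchIn-right k s))))) ⟩
      - altSign (toℕ k) (M zero (inject₁ k) * det (suc n) (minor (inject₁ k) M))
        ≈⟨ -‿cong (alt-≡ _ (P.sym (FinP.toℕ-inject₁ k))) ⟩
      - laplaceTerm M (inject₁ k)
        ≡⟨ P.cong (λ t → - laplaceTerm M t) (P.sym (adjSwap-right k)) ⟩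
      - laplaceTerm M (adjSwap k (suc k)) ∎
    ... | no j≢sk with adjSwap-punchIn-other k j j≢k j≢sk
    ... | k' , commute = begin
      altSign (toℕ j) (M zero (adjSwap k j) * det (suc n) (λ r s → M (suc r) (adjSwap k (punchIn j s))))
        ≈⟨ alt-cong (toℕ j) (*-cong (reflexive (P.cong (M zero) (adjSwap-other k j j≢k j≢sk)))
                                    (minor-columnSwap n k M j k' commute)) ⟩
      altSign (toℕ j) (M zero j * - det (suc n) (minor j M))
        ≈⟨ alt-cong (toℕ j) (sym (-‿distribʳ-* _ _)) ⟩
      altSign (toℕ j) (- (M zero j * det (suc n) (minor j M)))
        ≈⟨ alt-neg (toℕ j) _ ⟩
      - laplaceTerm M j
        ≡⟨ P.cong (λ t → - laplaceTerm M t) (P.sym (adjSwap-other k j j≢k j≢sk)) ⟩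
      - laplaceTerm M (adjSwap k j) ∎

    minor-columnSwap : ∀ n (k : Fin (suc n)) (M : SqMat (suc (suc n))) j (k' : Fin n) →
      (∀ s → adjSwap k (punchIn j s) ≡ punchIn j (adjSwap k' s)) →
      det (suc n) (λ r s → M (suc r) (adjSwap k (punchIn j s))) ≈ - det (suc n) (minor j M)
    minor-columnSwap (suc n) k M j k' commute =
      trans (det-≡ (suc (suc n)) (λ r s → P.cong (M (suc r)) (commute s))) (det-columnSwap n k' (minor j M))

  module TwoRowExpansion (n : ℕ) where
    doubleMinor : SqMat (suc (suc n)) → Fin (suc (suc n)) → Fin (suc n) → Carrier
    doubleMinor M a j' = det n (λ r s → M (suc (suc r)) (punchIn a (punchIn j' s)))

    twoRowTermDec : SqMat (suc (suc n)) → (a b : Fin (suc (suc n))) → Dec (a ≡ b) → Carrier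
    twoRowTermDec M a b (yes _) = 0#
    twoRowTermDec M a b (no a≢b) =
      altSign (toℕ a) (altSign (toℕ (punchOut a≢b)) (M zero a * (M (suc zero) b * doubleMinor M a (punchOut a≢b))))

    twoRowTerm : SqMat (suc (suc n)) → (a b : Fin (suc (suc n))) → Carrier
    twoRowTerm M a b = twoRowTermDec M a b (a Fin.≟ b)

    twoRowTerm-diagonal : ∀ M a (d : Dec (a ≡ a)) → twoRowTermDec M a a d ≈ 0#
    twoRowTerm-diagonal M a (yes _) = refl
    twoRowTerm-diagonal M a (no a≢a) = ⊥-elim (a≢a P.refl)

    twoRowTerm-offDiagonal : ∀ M a j' (d : Dec (a ≡ punchIn a j')) →
      twoRowTermDec M a (punchIn a j') d
        ≈ altSign (toℕ a) (altSign (toℕ j') (M zero a * (M (suc zero) (punchIn a j') * doubleMinor M a j')))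
    twoRowTerm-offDiagonal M a j' (yes eq) = ⊥-elim (FinP.punchInᵢ≢i a j' (P.sym eq))
    twoRowTerm-offDiagonal M a j' (no a≢b)
      with P.trans (FinP.punchOut-cong a {i≢j = a≢b} P.refl) (FinP.punchOut-punchIn a {j'})
    ... | eq rewrite eq = refl

    det-twoRows : ∀ M → det (suc (suc n)) M ≈ Σ-fin (suc (suc n)) (λ a → Σ-fin (suc (suc n)) (λ b → twoRowTerm M a b))
    det-twoRows M = Σ-cong (suc (suc n)) λ a → sym (begin
      Σ-fin (suc (suc n)) (λ b → twoRowTerm M a b)
        ≈⟨ Σ-remove (suc n) (twoRowTerm M a) a ⟩
      twoRowTerm M a a + Σ-fin (suc n) (λ j' → twoRowTerm M a (punchIn a j'))
        ≈⟨ +-cong (twoRowTerm-diagonal M a (a Fin.≟ a))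
                  (Σ-cong (suc n) (λ j' → twoRowTerm-offDiagonal M a j' (a Fin.≟ punchIn a j'))) ⟩
      0# + Σ-fin (suc n) (λ j' → altSign (toℕ a) (altSign (toℕ j') (M zero a * rest a j')))
        ≈⟨ +-identityˡ _ ⟩
      Σ-fin (suc n) (λ j' → altSign (toℕ a) (altSign (toℕ j') (M zero a * rest a j')))
        ≈⟨ sym (alt-Σ (toℕ a) (suc n) (λ j' → altSign (toℕ j') (M zero a * rest a j'))) ⟩
      altSign (toℕ a) (Σ-fin (suc n) (λ j' → altSign (toℕ j') (M zero a * rest a j')))
        ≈⟨ alt-cong (toℕ a) (Σ-cong (suc n) (λ j' → alt-*ˡ (toℕ j') (M zero a) (rest a j'))) ⟩
      altSign (toℕ a) (Σ-fin (suc n) (λ j' → M zero a * altSign (toℕ j') (rest a j')))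
        ≈⟨ alt-cong (toℕ a) (sym (Σ-*ˡ (suc n) (M zero a) (λ j' → altSign (toℕ j') (rest a j')))) ⟩
      altSign (toℕ a) (M zero a * det (suc n) (minor a M)) ∎)
      where
      rest : Fin (suc (suc n)) → Fin (suc n) → Carrier
      rest a j' = M (suc zero) (punchIn a j') * doubleMinor M a j'

    swapFirstRows : SqMat (suc (suc n)) → SqMat (suc (suc n))
    swapFirstRows M i j = M (adjSwap zero i) j

    twoRowTerm-swap : ∀ M a b (d₁ : Dec (a ≡ b)) (d₂ : Dec (b ≡ a)) →
      twoRowTermDec (swapFirstRows M) a b d₁ ≈ - twoRowTermDec M b a d₂
    twoRowTerm-swap M a b (yes _) (yes _) = sym -0#≈0#
    twoRowTerm-swap M a b (yes e) (no b≢a) = ⊥-elim (b≢a (P.sym e))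
    twoRowTerm-swap M a b (no a≢b) (yes e) = ⊥-elim (a≢b (P.sym e))
    twoRowTerm-swap M a b (no a≢b) (no b≢a) = begin
      altSign (toℕ a) (altSign (toℕ (punchOut a≢b)) (M (suc zero) a * (M zero b * doubleMinor M a (punchOut a≢b))))
        ≈⟨ alt-cong (toℕ a) (alt-cong (toℕ (punchOut a≢b)) (*-cong refl (*-cong refl
             (det-≡ n (λ r s → P.cong (M (suc (suc r))) (punchIn-punchOut-sym a b a≢b b≢a s)))))) ⟩
      altSign (toℕ a) (altSign (toℕ (punchOut a≢b)) (M (suc zero) a * (M zero b * doubleMinor M b (punchOut b≢a))))
        ≈⟨ alt-cong (toℕ a) (alt-cong (toℕ (punchOut a≢b)) (x*[y*z]≈y*[x*z] _ _ _)) ⟩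
      altSign (toℕ a) (altSign (toℕ (punchOut a≢b)) (M zero b * (M (suc zero) a * doubleMinor M b (punchOut b≢a))))
        ≈⟨ alt-punchOut a b a≢b b≢a _ ⟩
      - altSign (toℕ b) (altSign (toℕ (punchOut b≢a)) (M zero b * (M (suc zero) a * doubleMinor M b (punchOut b≢a)))) ∎
      where
      x*[y*z]≈y*[x*z] : ∀ x y z → x * (y * z) ≈ y * (x * z)
      x*[y*z]≈y*[x*z] x y z = trans (sym (*-assoc x y z)) (trans (*-cong (*-comm x y) refl) (*-assoc y x z))

    det-swapFirstRows : ∀ M → det (suc (suc n)) (swapFirstRows M) ≈ - det (suc (suc n)) M
    det-swapFirstRows M = begin
      det N (swapFirstRows M)                                         ≈⟨ det-twoRows (swapFirstRows M) ⟩
      Σ-fin N (λ a → Σ-fin N (λ b → twoRowTerm (swapFirstRows M) a b)) ≈⟨ Σ-cong N (λ a → Σ-cong N (λ b → twoRowTerm-swap M a b (a Fin.≟ b) (b Fin.≟ a))) ⟩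
      Σ-fin N (λ a → Σ-fin N (λ b → - twoRowTerm M b a))              ≈⟨ Σ-cong N (λ a → sym (Σ-neg N (λ b → twoRowTerm M b a))) ⟩
      Σ-fin N (λ a → - Σ-fin N (λ b → twoRowTerm M b a))              ≈⟨ sym (Σ-neg N (λ a → Σ-fin N (λ b → twoRowTerm M b a))) ⟩
      - Σ-fin N (λ a → Σ-fin N (λ b → twoRowTerm M b a))              ≈⟨ -‿cong (Σ-comm N N (λ a b → twoRowTerm M b a)) ⟩
      - Σ-fin N (λ b → Σ-fin N (λ a → twoRowTerm M b a))              ≈⟨ -‿cong (sym (det-twoRows M)) ⟩
      - det N M                                                        ∎
      where
      N : ℕ
      N = suc (suc n)

  -- Swapping two adjacent rows negates the determinant: rows 0, 1 by the
  -- two-row expansion, deeper rows by induction inside every minor.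
  det-rowSwap : ∀ n (k : Fin (suc n)) (M : SqMat (suc (suc n))) →
    det (suc (suc n)) (λ i j → M (adjSwap k i) j) ≈ - det (suc (suc n)) M
  det-rowSwap n zero M = TwoRowExpansion.det-swapFirstRows n M
  det-rowSwap (suc n) (suc k) M = begin
    Σ-fin N (λ j → altSign (toℕ j) (M zero j * det (suc (suc n)) (λ r s → minor j M (adjSwap k r) s)))
      ≈⟨ Σ-cong N (λ j → alt-cong (toℕ j) (*-cong (refl {M zero j}) (det-rowSwap n k (minor j M)))) ⟩
    Σ-fin N (λ j → altSign (toℕ j) (M zero j * - det (suc (suc n)) (minor j M)))
      ≈⟨ Σ-cong N (λ j → trans (alt-cong (toℕ j) (sym (-‿distribʳ-* (M zero j) (det (suc (suc n)) (minor j M)))))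
                                (alt-neg (toℕ j) (M zero j * det (suc (suc n)) (minor j M)))) ⟩
    Σ-fin N (λ j → - laplaceTerm M j)
      ≈⟨ sym (Σ-neg N (laplaceTerm M)) ⟩
    - det N M ∎
    where
    N : ℕ
    N = suc (suc (suc n))

  det-conj-adjSwap : ∀ n (k : Fin n) (M : SqMat (suc n)) →
    det (suc n) (λ i j → M (adjSwap k i) (adjSwap k j)) ≈ det (suc n) M
  det-conj-adjSwap (suc n) k M = begin
    det (suc (suc n)) (λ i j → M (adjSwap k i) (adjSwap k j)) ≈⟨ det-rowSwap n k (λ i j → M i (adjSwap k j)) ⟩
    - det (suc (suc n)) (λ i j → M i (adjSwap k j))           ≈⟨ -‿cong (det-columnSwap n k M) ⟩
    - - det (suc (suc n)) M                                   ≈⟨ -‿involutive _ ⟩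
    det (suc (suc n)) M                                       ∎

  det-conj-word : ∀ {n} {g : Fin n → Fin n} → AdjWord g → ∀ M → det n (λ i j → M (g i) (g j)) ≈ det n M
  det-conj-word idʷ M = refl
  det-conj-word {suc n} (swapʷ k) M = det-conj-adjSwap n k M
  det-conj-word (_∘ʷ_ {g = g} a b) M = trans (det-conj-word b (λ i j → M (g i) (g j))) (det-conj-word a M)
  det-conj-word {n} (extʷ a e) M =
    trans (det-≡ n (λ i j → P.cong₂ M (P.sym (e i)) (P.sym (e j)))) (det-conj-word a M)

  det-conj-permutation : ∀ n (π : Permutation′ n) M →
    det n (λ i j → M (π ⟨$⟩ʳ i) (π ⟨$⟩ʳ j)) ≈ det n M
  det-conj-permutation n π M = det-conj-word (permutation-word n π) M

  det-negate : ∀ n (M : SqMat n) → det n (λ i j → - M i j) ≈ altSign n (det n M)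
  det-negate zero M = refl
  det-negate (suc n) M = begin
    Σ-fin (suc n) (λ j → altSign (toℕ j) (- M zero j * det n (λ r s → - minor j M r s)))
      ≈⟨ Σ-cong (suc n) (λ j → alt-cong (toℕ j) (*-cong (refl { - M zero j }) (det-negate n (minor j M)))) ⟩
    Σ-fin (suc n) (λ j → altSign (toℕ j) (- M zero j * altSign n (det n (minor j M))))
      ≈⟨ Σ-cong (suc n) (λ j → alt-cong (toℕ j) (trans (sym (-‿distribˡ-* _ _))
                                   (-‿cong (sym (alt-*ˡ n (M zero j) (det n (minor j M))))))) ⟩
    Σ-fin (suc n) (λ j → altSign (toℕ j) (altSign (suc n) (M zero j * det n (minor j M))))
      ≈⟨ Σ-cong (suc n) (λ j → alt-comm (toℕ j) (suc n) (M zero j * det n (minor j M))) ⟩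
    Σ-fin (suc n) (λ j → altSign (suc n) (laplaceTerm M j))
      ≈⟨ sym (alt-Σ (suc n) (suc n) (laplaceTerm M)) ⟩
    altSign (suc n) (det (suc n) M) ∎

-- F[X] (coefficient sequences with convolution product) is a commutative
-- ring whose underlying raw ring is exactly Over.polyRawRing, so the
-- determinant theory above applies to characteristic matrices.

module PolynomialRing {c ℓ} (F : Field c ℓ) where
  open Field F hiding (zero)
  open RingSums commutativeRing
  open Over F
  open import Relation.Binary.Reasoning.Setoid setoid

  coeff-* : ∀ f g k → (f *ₚ g) k ≡ Σℕ (suc k) (λ i → f i * g (k ∸ i))
  coeff-* f g k = Σ-fin≡Σℕ (suc k) (λ i → f i * g (k ∸ i))

  coeff-0ₚ : ∀ k → 0ₚ k ≡ 0#
  coeff-0ₚ zero = P.refl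
  coeff-0ₚ (suc k) = P.refl

  ≈ₚ-isEquivalence : IsEquivalence _≈ₚ_
  ≈ₚ-isEquivalence = record
    { refl = λ k → refl ; sym = λ e k → sym (e k) ; trans = λ e e' k → trans (e k) (e' k) }

  *ₚ-cong : ∀ {f f' g g'} → f ≈ₚ f' → g ≈ₚ g' → (f *ₚ g) ≈ₚ (f' *ₚ g')
  *ₚ-cong e e' k = Σ-cong (suc k) (λ i → *-cong (e (toℕ i)) (e' (k ∸ toℕ i)))

  -- Commutativity: reverse the order of the convolution sum.
  *ₚ-comm : ∀ f g → (f *ₚ g) ≈ₚ (g *ₚ f)
  *ₚ-comm f g k = begin
    (f *ₚ g) k                                       ≡⟨ coeff-* f g k ⟩
    Σℕ (suc k) (λ i → f i * g (k ∸ i))               ≈⟨ Σℕ-reverse (suc k) (λ i → f i * g (k ∸ i)) ⟩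
    Σℕ (suc k) (λ i → f (k ∸ i) * g (k ∸ (k ∸ i)))   ≈⟨ Σℕ-cong (suc k) {g = λ i → g i * f (k ∸ i)} (λ i i≤k → trans (*-comm _ _)
                                                          (*-cong (reflexive (P.cong g (ℕP.m∸[m∸n]≡n (ℕP.≤-pred i≤k)))) refl)) ⟩
    Σℕ (suc k) (λ i → g i * f (k ∸ i))               ≡⟨ P.sym (coeff-* g f k) ⟩
    (g *ₚ f) k                                       ∎

  *ₚ-identityˡ : ∀ f → (1ₚ *ₚ f) ≈ₚ f
  *ₚ-identityˡ f k = begin
    1# * f k + Σ-fin k (λ i → 0# * f (k ∸ toℕ (suc i))) ≈⟨ +-cong (*-identityˡ _) (Σ-zero k (λ i → zeroˡ _)) ⟩
    f k + 0#                                             ≈⟨ +-identityʳ _ ⟩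
    f k                                                  ∎

  *ₚ-distribˡ : ∀ f g h → (f *ₚ (g +ₚ h)) ≈ₚ ((f *ₚ g) +ₚ (f *ₚ h))
  *ₚ-distribˡ f g h k = trans (Σ-cong (suc k) (λ i → distribˡ (f (toℕ i)) (g (k ∸ toℕ i)) (h (k ∸ toℕ i))))
                              (Σ-+ (suc k) (λ i → f (toℕ i) * g (k ∸ toℕ i)) (λ i → f (toℕ i) * h (k ∸ toℕ i)))

  *ₚ-distribʳ : ∀ f g h → ((g +ₚ h) *ₚ f) ≈ₚ ((g *ₚ f) +ₚ (h *ₚ f))
  *ₚ-distribʳ f g h k = begin
    ((g +ₚ h) *ₚ f) k         ≈⟨ *ₚ-comm (g +ₚ h) f k ⟩
    (f *ₚ (g +ₚ h)) k         ≈⟨ *ₚ-distribˡ f g h k ⟩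
    (f *ₚ g) k + (f *ₚ h) k   ≈⟨ +-cong (*ₚ-comm f g k) (*ₚ-comm f h k) ⟩
    (g *ₚ f) k + (h *ₚ f) k   ∎

  -- Associativity: both sides are the sum of f j g l h r over j + l + r = k,
  -- regrouped by exchanging a triangular double sum.
  *ₚ-assoc : ∀ f g h → ((f *ₚ g) *ₚ h) ≈ₚ (f *ₚ (g *ₚ h))
  *ₚ-assoc f g h k = begin
    ((f *ₚ g) *ₚ h) k
      ≡⟨ coeff-* (f *ₚ g) h k ⟩
    Σℕ (suc k) (λ i → (f *ₚ g) i * h (k ∸ i))
      ≈⟨ Σℕ-cong (suc k) (λ i _ → reflexive (P.cong (_* h (k ∸ i)) (coeff-* f g i))) ⟩
    Σℕ (suc k) (λ i → Σℕ (suc i) (λ j → f j * g (i ∸ j)) * h (k ∸ i))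
      ≈⟨ Σℕ-cong (suc k) (λ i _ → Σℕ-*ʳ (suc i) (h (k ∸ i)) (λ j → f j * g (i ∸ j))) ⟩
    Σℕ (suc k) (λ i → Σℕ (suc i) (λ j → f j * g (i ∸ j) * h (k ∸ i)))
      ≈⟨ Σℕ-triangle k (λ i j → f j * g (i ∸ j) * h (k ∸ i)) ⟩
    Σℕ (suc k) (λ j → Σℕ (suc (k ∸ j)) (λ l → f j * g (j ℕ.+ l ∸ j) * h (k ∸ (j ℕ.+ l))))
      ≈⟨ Σℕ-cong (suc k) (λ j _ → Σℕ-cong (suc (k ∸ j)) {g = λ l → f j * (g l * h (k ∸ j ∸ l))} (λ l _ → trans (*-assoc _ _ _)
           (*-cong refl (*-cong (reflexive (P.cong g (ℕP.m+n∸m≡n j l)))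
                                (reflexive (P.cong h (P.sym (ℕP.∸-+-assoc k j l)))))))) ⟩
    Σℕ (suc k) (λ j → Σℕ (suc (k ∸ j)) (λ l → f j * (g l * h (k ∸ j ∸ l))))
      ≈⟨ Σℕ-cong (suc k) (λ j _ → sym (Σℕ-*ˡ (suc (k ∸ j)) (f j) (λ l → g l * h (k ∸ j ∸ l)))) ⟩
    Σℕ (suc k) (λ j → f j * Σℕ (suc (k ∸ j)) (λ l → g l * h (k ∸ j ∸ l)))
      ≈⟨ Σℕ-cong (suc k) (λ j _ → reflexive (P.cong (f j *_) (P.sym (coeff-* g h (k ∸ j))))) ⟩
    Σℕ (suc k) (λ j → f j * (g *ₚ h) (k ∸ j))
      ≡⟨ P.sym (coeff-* f (g *ₚ h) k) ⟩
    (f *ₚ (g *ₚ h)) k ∎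

  polyIsCommutativeRing : IsCommutativeRing _≈ₚ_ _+ₚ_ _*ₚ_ -ₚ_ 0ₚ 1ₚ
  polyIsCommutativeRing = record
    { isRing = record
      { +-isAbelianGroup = record
        { isGroup = record
          { isMonoid = record
            { isSemigroup = record
              { isMagma = record { isEquivalence = ≈ₚ-isEquivalence ; ∙-cong = λ e e' k → +-cong (e k) (e' k) }
              ; assoc = λ f g h k → +-assoc (f k) (g k) (h k) }
            ; identity = (λ f k → trans (+-cong (reflexive (coeff-0ₚ k)) refl) (+-identityˡ (f k)))
                       , (λ f k → trans (+-cong refl (reflexive (coeff-0ₚ k))) (+-identityʳ (f k))) }
          ; inverse = (λ f k → trans (-‿inverseˡ (f k)) (reflexive (P.sym (coeff-0ₚ k))))
                    , (λ f k → trans (-‿inverseʳ (f k)) (reflexive (P.sym (coeff-0ₚ k))))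
          ; ⁻¹-cong = λ e k → -‿cong (e k) }
        ; comm = λ f g k → +-comm (f k) (g k) }
      ; *-cong = *ₚ-cong
      ; *-assoc = *ₚ-assoc
      ; *-identity = *ₚ-identityˡ , (λ f k → trans (*ₚ-comm f 1ₚ k) (*ₚ-identityˡ f k))
      ; distrib = *ₚ-distribˡ , *ₚ-distribʳ }
    ; *-comm = *ₚ-comm }

  polyRing : CommutativeRing c ℓ
  polyRing = record { isCommutativeRing = polyIsCommutativeRing }

module Companion {c ℓ} (F : Field c ℓ) where
  open Field F hiding (zero)
  open Over F
  open PolynomialRing F using (polyRing)
  private
    module R = CommutativeRing polyRing
    module PD = Determinant polyRing
    module FD = Determinant commutativeRing
  open import Relation.Binary.Reasoning.Setoid R.setoid
  open import Algebra.Properties.Ring R.ring using (-1*x≈-x)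

  companionEntry : (ℕ → Carrier) → ℕ → ℕ → ℕ → Carrier
  companionEntry cf N i j =
    if does (j ℕ.≟ N ∸ 1) then - cf i else if does (i ℕ.≟ suc j) then 1# else 0#

  companion : (ℕ → Carrier) → ∀ N → Mat N
  companion cf N i j = companionEntry cf N (toℕ i) (toℕ j)

  charMatrix : ∀ {N} → Mat N → Fin N → Fin N → Pol
  charMatrix T i j = (if does (i Fin.≟ j) then Xₚ else 0ₚ) +ₚ (-ₚ constₚ (T i j))

  monicWith : ℕ → (ℕ → Carrier) → Pol
  monicWith zero cf = 1ₚ
  monicWith (suc N) cf = constₚ (cf 0) +ₚ (Xₚ *ₚ monicWith N (λ i → cf (suc i)))

  constₚ-cong : ∀ {x y} → x ≈ y → constₚ x ≈ₚ constₚ y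
  constₚ-cong e zero = e
  constₚ-cong e (suc k) = refl

  -ₚconstₚ- : ∀ x → (-ₚ constₚ (- x)) ≈ₚ constₚ x
  -ₚconstₚ- x zero = FD.-‿involutive x
  -ₚconstₚ- x (suc k) = FD.-0#≈0#

  -ₚconstₚ0 : (-ₚ constₚ 0#) ≈ₚ 0ₚ
  -ₚconstₚ0 zero = FD.-0#≈0#
  -ₚconstₚ0 (suc k) = FD.-0#≈0#

  charMatrix-offDiagonal : ∀ {N} (T : Mat N) i j → i ≢ j → charMatrix T i j ≈ₚ (-ₚ constₚ (T i j))
  charMatrix-offDiagonal T i j i≢j = R.trans (R.+-cong (R.reflexive (if-no (i Fin.≟ j) i≢j)) R.refl) (R.+-identityˡ _)

  charMatrix-offDiagonal-0 : ∀ {N} (T : Mat N) i j → i ≢ j → T i j ≈ 0# → charMatrix T i j ≈ₚ 0ₚ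
  charMatrix-offDiagonal-0 T i j i≢j e =
    R.trans (charMatrix-offDiagonal T i j i≢j) (R.trans (R.-‿cong (constₚ-cong e)) -ₚconstₚ0)

  charMatrix-diagonal-0 : ∀ {N} (T : Mat N) i → T i i ≈ 0# → charMatrix T i i ≈ₚ Xₚ
  charMatrix-diagonal-0 T i e =
    R.trans (R.+-cong (R.reflexive (if-yes (i Fin.≟ i) P.refl)) (R.trans (R.-‿cong (constₚ-cong e)) -ₚconstₚ0)) (R.+-identityʳ Xₚ)

  -- Deleting row 0 and the last column of X·I − companion leaves this
  -- matrix: −1 on the diagonal, X just above it.
  bidiagonal : ∀ m → Fin m → Fin m → Pol
  bidiagonal m r s = (if does (toℕ s ℕ.≟ suc (toℕ r)) then Xₚ else 0ₚ) +ₚ (-ₚ constₚ (if does (r Fin.≟ s) then 1# else 0#))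

  0ₚ-ₚconstₚ0 : (0ₚ +ₚ (-ₚ constₚ 0#)) ≈ₚ 0ₚ
  0ₚ-ₚconstₚ0 = R.trans (R.+-identityˡ _) -ₚconstₚ0

  -- It is upper triangular, so its determinant is (−1)^m.
  det-bidiagonal : ∀ m → PD.det m (bidiagonal m) R.≈ PD.altSign m 1ₚ
  det-bidiagonal zero = R.refl
  det-bidiagonal (suc m) = begin
    PD.det (suc m) (bidiagonal (suc m))                      ≈⟨ PD.Σ-single m (PD.laplaceTerm (bidiagonal (suc m))) zero (offFirst m) ⟩
    bidiagonal (suc m) zero zero R.* PD.det m (bidiagonal m) ≈⟨ R.*-cong (R.+-identityˡ (-ₚ 1ₚ)) (det-bidiagonal m) ⟩
    (-ₚ 1ₚ) R.* PD.altSign m 1ₚ                               ≈⟨ -1*x≈-x _ ⟩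
    PD.altSign (suc m) 1ₚ                                     ∎
    where
    -- Column 1 leaves a minor with a zero first column; later columns have a
    -- zero entry in row 0.
    offFirst : ∀ m (j : Fin (suc m)) → j ≢ zero → PD.laplaceTerm (bidiagonal (suc m)) j R.≈ 0ₚ
    offFirst m zero j≢0 = ⊥-elim (j≢0 P.refl)
    offFirst (suc m) (suc zero) _ = R.trans (PD.alt-cong 1
      (R.trans (R.*-cong (R.refl {bidiagonal (suc (suc m)) zero (suc zero)})
                         (PD.det-zeroColumn m (PD.minor (suc zero) (bidiagonal (suc (suc m)))) (λ r → 0ₚ-ₚconstₚ0)))
               (R.zeroʳ (bidiagonal (suc (suc m)) zero (suc zero))))) (PD.alt-0 1)
    offFirst (suc m) (suc (suc j)) _ = PD.laplaceTerm-zeroEntry (bidiagonal (suc (suc m))) (suc (suc j)) 0ₚ-ₚconstₚ0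

  punchIn-last : ∀ {n} (s : Fin n) → punchIn (fromℕ n) s ≡ inject₁ s
  punchIn-last zero = P.refl
  punchIn-last (suc s) = P.cong suc (punchIn-last s)

  companionEntry-belowLast : ∀ cf n (r s : Fin (suc n)) →
    companionEntry cf (suc (suc n)) (suc (toℕ r)) (toℕ (inject₁ s)) ≡ (if does (r Fin.≟ s) then 1# else 0#)
  companionEntry-belowLast cf n r s = P.trans (if-no (toℕ (inject₁ s) ℕ.≟ suc n) notLast)
    (P.cong (λ b → if b then 1# else 0#) (does-⇔ (suc (toℕ r) ℕ.≟ suc (toℕ (inject₁ s))) (r Fin.≟ s)
      (λ e → FinP.toℕ-injective (P.trans (ℕP.suc-injective e) (FinP.toℕ-inject₁ s)))
      (λ e → P.cong suc (P.trans (P.cong toℕ e) (P.sym (FinP.toℕ-inject₁ s))))))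
    where
    notLast : toℕ (inject₁ s) ≢ suc n
    notLast = ℕP.<⇒≢ (P.subst (ℕ._< suc n) (P.sym (FinP.toℕ-inject₁ s)) (FinP.toℕ<n s))

  minor-last : ∀ cf n (r s : Fin (suc n)) →
    charMatrix (companion cf (suc (suc n))) (suc r) (inject₁ s) ≡ bidiagonal (suc n) r s
  minor-last cf n r s = P.cong₂ _+ₚ_
    (P.cong (λ b → if b then Xₚ else 0ₚ) (does-⇔ (suc r Fin.≟ inject₁ s) (toℕ s ℕ.≟ suc (toℕ r))
      (λ e → P.sym (P.trans (P.cong toℕ e) (FinP.toℕ-inject₁ s)))
      (λ e → FinP.toℕ-injective (P.trans (P.sym e) (P.sym (FinP.toℕ-inject₁ s))))))
    (P.cong (λ x → -ₚ constₚ x) (companionEntry-belowLast cf n r s))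

  -- Expanding along row 0 leaves two terms: X times the characteristic
  -- polynomial of the companion matrix of c₁, …, c_{N-1}, and c₀ times the
  -- bidiagonal minor, of determinant ±1.
  charPoly-companion-step : ∀ n cf →
    PD.det (suc n) (charMatrix (companion (λ i → cf (suc i)) (suc n))) R.≈ monicWith (suc n) (λ i → cf (suc i)) →
    PD.det (suc (suc n)) (charMatrix (companion cf (suc (suc n)))) R.≈ monicWith (suc (suc n)) cf
  charPoly-companion-step n cf IH = begin
    PD.det (suc (suc n)) A                                          ≡⟨⟩
    term zero R.+ PD.Σ-fin (suc n) (λ j → term (suc j))             ≈⟨ R.+-cong R.refl (PD.Σ-single n (λ j → term (suc j)) (fromℕ n) middle) ⟩
    term zero R.+ term lastCol                                      ≈⟨ R.+-cong first lastTerm ⟩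
    (Xₚ R.* monicWith (suc n) (λ i → cf (suc i))) R.+ constₚ (cf 0) ≈⟨ R.+-comm _ _ ⟩
    monicWith (suc (suc n)) cf                                      ∎
    where
    A : Fin (suc (suc n)) → Fin (suc (suc n)) → Pol
    A = charMatrix (companion cf (suc (suc n)))
    term : Fin (suc (suc n)) → Pol
    term = PD.laplaceTerm A
    lastCol : Fin (suc (suc n))
    lastCol = suc (fromℕ n)
    first : term zero R.≈ Xₚ R.* monicWith (suc n) (λ i → cf (suc i))
    first = R.*-cong (charMatrix-diagonal-0 (companion cf (suc (suc n))) zero refl) IH
    cornerEntry : A zero lastCol R.≈ constₚ (cf 0)
    cornerEntry = R.trans (charMatrix-offDiagonal (companion cf (suc (suc n))) zero lastCol (λ ()))
      (R.trans (R.-‿cong (R.reflexive (P.cong constₚ (if-yes (toℕ lastCol ℕ.≟ suc n) (P.cong suc (FinP.toℕ-fromℕ n))))))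
               (-ₚconstₚ- (cf 0)))
    lastMinor : Pol
    lastMinor = PD.det (suc n) (PD.minor lastCol A)
    lastTerm : term lastCol R.≈ constₚ (cf 0)
    lastTerm = begin
      PD.altSign (suc (toℕ (fromℕ n))) (A zero lastCol R.* lastMinor)
        ≈⟨ PD.alt-≡ (A zero lastCol R.* lastMinor) (P.cong suc (FinP.toℕ-fromℕ n)) ⟩
      PD.altSign (suc n) (A zero lastCol R.* lastMinor)
        ≈⟨ PD.alt-cong (suc n) (R.*-cong cornerEntry
             (PD.det-≡ (suc n) (λ r s → P.trans (P.cong (A (suc r)) (punchIn-last {suc n} s)) (minor-last cf n r s)))) ⟩
      PD.altSign (suc n) (constₚ (cf 0) R.* PD.det (suc n) (bidiagonal (suc n)))
        ≈⟨ PD.alt-cong (suc n) (R.*-cong (R.refl {constₚ (cf 0)}) (det-bidiagonal (suc n))) ⟩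
      PD.altSign (suc n) (constₚ (cf 0) R.* PD.altSign (suc n) 1ₚ)
        ≈⟨ PD.alt-*ˡ (suc n) (constₚ (cf 0)) (PD.altSign (suc n) 1ₚ) ⟩
      constₚ (cf 0) R.* PD.altSign (suc n) (PD.altSign (suc n) 1ₚ)
        ≈⟨ R.*-cong (R.refl {constₚ (cf 0)}) (PD.alt-alt (suc n) 1ₚ) ⟩
      constₚ (cf 0) R.* 1ₚ
        ≈⟨ R.*-identityʳ _ ⟩
      constₚ (cf 0) ∎
    middle : ∀ j → j ≢ fromℕ n → term (suc j) R.≈ 0ₚ
    middle j j≢n = PD.laplaceTerm-zeroEntry A (suc j)
      (charMatrix-offDiagonal-0 (companion cf (suc (suc n))) zero (suc j) (λ ())
        (reflexive (if-no (suc (toℕ j) ℕ.≟ suc n) (notLast ∘ ℕP.suc-injective))))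
      where
      notLast : toℕ j ≢ suc n ∸ 1
      notLast q = j≢n (FinP.toℕ-injective (P.trans q (P.sym (FinP.toℕ-fromℕ n))))

  charPoly-companion : ∀ N cf → charPoly (companion cf N) ≈ₚ monicWith N cf
  charPoly-companion zero cf = R.refl
  charPoly-companion (suc zero) cf = begin
    (Xₚ +ₚ (-ₚ constₚ (- cf 0))) R.* 1ₚ R.+ 0ₚ ≈⟨ R.trans (R.+-identityʳ _) (R.*-identityʳ _) ⟩
    Xₚ +ₚ (-ₚ constₚ (- cf 0))                 ≈⟨ R.+-cong R.refl (-ₚconstₚ- (cf 0)) ⟩
    Xₚ +ₚ constₚ (cf 0)                        ≈⟨ R.+-comm _ _ ⟩
    constₚ (cf 0) +ₚ Xₚ                        ≈⟨ R.+-cong R.refl (R.sym (R.*-identityʳ Xₚ)) ⟩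
    monicWith 1 cf                             ∎
  charPoly-companion (suc (suc n)) cf =
    charPoly-companion-step n cf (charPoly-companion (suc n) (λ i → cf (suc i)))

  X*-coeff-0 : ∀ g → (Xₚ *ₚ g) 0 ≈ 0#
  X*-coeff-0 g = trans (+-identityʳ _) (zeroˡ _)

  X*-coeff-suc : ∀ g k → (Xₚ *ₚ g) (suc k) ≈ g k
  X*-coeff-suc g k = trans (+-cong (zeroˡ _) (+-cong (*-identityˡ _) (FD.Σ-zero k (λ i → zeroˡ _))))
                           (trans (+-identityˡ _) (+-identityʳ _))

  monicWith-monic : ∀ N f → Monic N f → monicWith N f ≈ₚ f
  monicWith-monic zero f (lead , above) zero = sym lead
  monicWith-monic zero f (lead , above) (suc k) = sym (above (suc k) (ℕ.s≤s ℕ.z≤n))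
  monicWith-monic (suc N) f _ zero = trans (+-cong refl (X*-coeff-0 (monicWith N (λ i → f (suc i))))) (+-identityʳ _)
  monicWith-monic (suc N) f (lead , above) (suc k) =
    trans (+-identityˡ _) (trans (X*-coeff-suc (monicWith N (λ i → f (suc i))) k)
      (monicWith-monic N (λ i → f (suc i)) (lead , (λ j N<j → above (suc j) (ℕ.s≤s N<j))) k))

  charPoly-coeff-0 : ∀ N (T : Mat N) → charPoly T 0 ≈ FD.altSign N (FD.det N T)
  charPoly-coeff-0 N T = trans (det-coeff-0 N _)
    (trans (FD.det-cong N (λ i j → trans (+-cong (reflexive (diagonal-coeff-0 (does (i Fin.≟ j)))) refl) (+-identityˡ _)))
           (FD.det-negate N T))
    where
    Σ-coeff-0 : ∀ n (h : Fin n → Pol) → PD.Σ-fin n h 0 ≈ FD.Σ-fin n (λ j → h j 0)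
    Σ-coeff-0 zero h = refl
    Σ-coeff-0 (suc n) h = +-cong refl (Σ-coeff-0 n (λ j → h (suc j)))
    alt-coeff-0 : ∀ j x → PD.altSign j x 0 ≡ FD.altSign j (x 0)
    alt-coeff-0 zero x = P.refl
    alt-coeff-0 (suc j) x = P.cong -_ (alt-coeff-0 j x)
    det-coeff-0 : ∀ N (M : Fin N → Fin N → Pol) → PD.det N M 0 ≈ FD.det N (λ i j → M i j 0)
    det-coeff-0 zero M = refl
    det-coeff-0 (suc N) M = trans (Σ-coeff-0 (suc N) (PD.laplaceTerm M)) (FD.Σ-cong (suc N) λ j →
      trans (reflexive (alt-coeff-0 (toℕ j) (M zero j *ₚ PD.det N (PD.minor j M))))
            (FD.alt-cong (toℕ j) (trans (+-identityʳ _) (*-cong (refl {M zero j 0}) (det-coeff-0 N (PD.minor j M))))))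
    diagonal-coeff-0 : ∀ b → (if b then Xₚ else 0ₚ) 0 ≡ 0#
    diagonal-coeff-0 true = P.refl
    diagonal-coeff-0 false = P.refl

-- In an (m,n)-block
-- matrix of size N = n·m, index combine i a (= i·m + a) is row a of block i;
-- σ sends it to position a·n + i of the ordinary companion ordering.

module BlockCompanion {c ℓ} (F : Field c ℓ) (m n' : ℕ) where
  open Field F hiding (zero)
  open Over F
  open Companion F
  module R = CommutativeRing (PolynomialRing.polyRing F)
  module PD = Determinant (PolynomialRing.polyRing F)

  n N : ℕ
  n = suc n'
  N = n ℕ.* m

  m*n≡N : m ℕ.* n ≡ N
  m*n≡N = ℕP.*-comm m n

  pos : Fin n → Fin m → Fin N
  pos i a = cast m*n≡N (combine {m} {n} a i)

  toℕ-pos : ∀ i a → toℕ (pos i a) ≡ n ℕ.* toℕ a ℕ.+ toℕ i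
  toℕ-pos i a = P.trans (FinP.toℕ-cast m*n≡N (combine {m} {n} a i)) (FinP.toℕ-combine a i)

  σ σ⁻¹ : Fin N → Fin N
  σ k = pos (proj₁ (remQuot {n} m k)) (proj₂ (remQuot {n} m k))
  σ⁻¹ k = combine {n} {m} (proj₂ (remQuot {m} n k′)) (proj₁ (remQuot {m} n k′))
    where
    k′ : Fin (m ℕ.* n)
    k′ = cast (P.sym m*n≡N) k

  σ-combine : ∀ i a → σ (combine {n} {m} i a) ≡ pos i a
  σ-combine i a = P.cong (λ p → pos (proj₁ p) (proj₂ p)) (FinP.remQuot-combine {n} {m} i a)

  σ⁻¹-σ : ∀ k → σ⁻¹ (σ k) ≡ k
  σ⁻¹-σ k = P.trans (P.cong (λ p → combine {n} {m} (proj₂ p) (proj₁ p))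
                      (P.trans (P.cong (remQuot {m} n) (FinP.cast-involutive (P.sym m*n≡N) m*n≡N _))
                               (FinP.remQuot-combine {m} {n} _ _)))
                    (FinP.combine-remQuot {n} m k)

  σ-σ⁻¹ : ∀ k → σ (σ⁻¹ k) ≡ k
  σ-σ⁻¹ k = P.trans (σ-combine (proj₂ (remQuot {m} n k′)) (proj₁ (remQuot {m} n k′)))
              (P.trans (P.cong (cast m*n≡N) (FinP.combine-remQuot {m} n k′)) (FinP.cast-involutive m*n≡N (P.sym m*n≡N) k))
    where
    k′ : Fin (m ℕ.* n)
    k′ = cast (P.sym m*n≡N) k

  σ-injective : ∀ {i j} → σ i ≡ σ j → i ≡ j
  σ-injective {i} {j} e = P.trans (P.sym (σ⁻¹-σ i)) (P.trans (P.cong σ⁻¹ e) (σ⁻¹-σ j))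

  σ-perm : Permutation′ N
  σ-perm = permutation σ σ⁻¹ σ-σ⁻¹ σ⁻¹-σ

  blockCompanionOf : (ℕ → Carrier) → Mat N
  blockCompanionOf cf k l = companion cf N (σ k) (σ l)

  lastBlocks : (ℕ → Carrier) → Fin n → Fin m → Fin m → Carrier
  lastBlocks cf i a b = blockCompanionOf cf (combine {n} {m} i a) (combine {n} {m} (fromℕ n') b)

  blockEntry : (ℕ → Carrier) → Fin n × Fin m → Fin n × Fin m → Carrier
  blockEntry cf (i , a) (j , b) =
    if does (toℕ j ℕ.≟ n ∸ 1) then lastBlocks cf i a b
    else if does (toℕ i ℕ.≟ suc (toℕ j)) ∧ does (a Fin.≟ b) then 1#
    else 0#

  -- Outside the last block column, position a·n + i lies just below b·n + j
  -- exactly when a = b and i = j + 1; and b·n + j is never the last column.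
  companionEntry-pos : ∀ cf p q →
    companionEntry cf N (toℕ (pos (proj₁ p) (proj₂ p))) (toℕ (pos (proj₁ q) (proj₂ q))) ≡ blockEntry cf p q
  companionEntry-pos cf (i , a) (j , b) with toℕ j ℕ.≟ n'
  ... | yes j≡n' with FinP.toℕ-injective (P.trans j≡n' (P.sym (FinP.toℕ-fromℕ n')))
  ... | P.refl = P.sym (P.trans (if-yes (toℕ (fromℕ n') ℕ.≟ n') j≡n')
                   (P.cong₂ (λ u v → companionEntry cf N (toℕ u) (toℕ v)) (σ-combine i a) (σ-combine (fromℕ n') b)))
  companionEntry-pos cf (i , a) (j , b) | no j≢n' =
    P.trans (if-no (y ℕ.≟ N ∸ 1) y≢last)
      (P.trans (P.cong (λ t → if t then 1# else 0#)
                 (does-⇔-∧ (x ℕ.≟ suc y) (toℕ i ℕ.≟ suc (toℕ j)) (a Fin.≟ b) below⇒ ⇒below))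
               (P.sym (if-no (toℕ j ℕ.≟ n ∸ 1) j≢n')))
    where
    x y : ℕ
    x = toℕ (pos i a)
    y = toℕ (pos j b)
    1+j<n : suc (toℕ j) ℕ.< n
    1+j<n = ℕ.s≤s (ℕP.≤∧≢⇒< (ℕP.≤-pred (FinP.toℕ<n j)) j≢n')
    j+1 : Fin n
    j+1 = fromℕ< 1+j<n
    1+y≡ : suc y ≡ n ℕ.* toℕ b ℕ.+ suc (toℕ j)
    1+y≡ = P.trans (P.cong suc (toℕ-pos j b)) (P.sym (ℕP.+-suc (n ℕ.* toℕ b) (toℕ j)))
    1+y<N : suc y ℕ.< N
    1+y<N = ℕP.<-≤-trans (P.subst (ℕ._< n ℕ.* toℕ b ℕ.+ n) (P.sym 1+y≡) (ℕP.+-monoʳ-< (n ℕ.* toℕ b) 1+j<n))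
              (P.subst (ℕ._≤ N) (P.trans (ℕP.*-suc n (toℕ b)) (ℕP.+-comm n (n ℕ.* toℕ b))) (ℕP.*-monoʳ-≤ n (FinP.toℕ<n b)))
    y≢last : y ≢ N ∸ 1
    y≢last = lemma y N 1+y<N
      where
      lemma : ∀ y M → suc y ℕ.< M → y ≢ M ∸ 1
      lemma y (suc M) lt eq = ℕP.<-irrefl (P.cong suc eq) lt
    below⇒ : x ≡ suc y → (toℕ i ≡ suc (toℕ j)) × (a ≡ b)
    below⇒ e with FinP.combine-injective a i b j+1 (FinP.toℕ-injective
                    (P.trans (P.sym (FinP.toℕ-cast m*n≡N (combine {m} {n} a i)))
                    (P.trans e (P.trans 1+y≡ (P.trans (P.cong (n ℕ.* toℕ b ℕ.+_) (P.sym (FinP.toℕ-fromℕ< 1+j<n)))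
                                                      (P.sym (FinP.toℕ-combine b j+1)))))))
    ... | a≡b , i≡j+1 = P.trans (P.cong toℕ i≡j+1) (FinP.toℕ-fromℕ< 1+j<n) , a≡b
    ⇒below : toℕ i ≡ suc (toℕ j) → a ≡ b → x ≡ suc y
    ⇒below e P.refl = P.trans (toℕ-pos i a) (P.trans (P.cong (n ℕ.* toℕ a ℕ.+_) e) (P.sym 1+y≡))

  blockCompanionOf-isBlockCompanion : ∀ cf → IsBlockCompanion m n (blockCompanionOf cf)
  blockCompanionOf-isBlockCompanion cf =
    lastBlocks cf , λ k l → reflexive (companionEntry-pos cf (remQuot {n} m k) (remQuot {n} m l))

  -- Conjugation by σ preserves the characteristic polynomial.
  charPoly-blockCompanionOf : ∀ cf → charPoly (blockCompanionOf cf) ≈ₚ monicWith N cf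
  charPoly-blockCompanionOf cf =
    R.trans (PD.det-≡ N entry) (R.trans (PD.det-conj-permutation N σ-perm (charMatrix (companion cf N)))
                                        (charPoly-companion N cf))
    where
    entry : ∀ i j → charMatrix (blockCompanionOf cf) i j ≡ charMatrix (companion cf N) (σ i) (σ j)
    entry i j = P.cong (λ t → (if t then Xₚ else 0ₚ) +ₚ (-ₚ constₚ (blockCompanionOf cf i j)))
                       (does-⇔ (i Fin.≟ j) (σ i Fin.≟ σ j) (P.cong σ) σ-injective)

  charPoly-blockCompanion-monic : ∀ f → Monic (m ℕ.* n) f → charPoly (blockCompanionOf f) ≈ₚ f
  charPoly-blockCompanion-monic f monic =
    R.trans (charPoly-blockCompanionOf f) (monicWith-monic N f (P.subst (λ d → Monic d f) m*n≡N monic))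

module FieldFacts {c ℓ} (K : Field c ℓ) where
  open Field K hiding (zero)
  open import Relation.Binary.Reasoning.Setoid setoid
  open import Algebra.Properties.Ring ring using (-‿distribʳ-*)

  ≈-dec : ∀ {Q} → HasSize K Q → ∀ x y → Dec (x ≈ y)
  ≈-dec (enum , onto , inj) x y with onto x | onto y
  ... | i , ei | j , ej with i Fin.≟ j
  ... | yes P.refl = yes (trans (sym ei) ej)
  ... | no i≢j = no (λ x≈y → i≢j (inj i j (trans ei (trans x≈y (sym ej)))))

  *-zero-right : ∀ x y → ¬ (x ≈ 0#) → x * y ≈ 0# → y ≈ 0#
  *-zero-right x y x≉0 e with inverse x x≉0
  ... | x⁻¹ , xx⁻¹≈1 = begin
    y              ≈⟨ sym (*-identityˡ y) ⟩
    1# * y         ≈⟨ *-cong (sym xx⁻¹≈1) refl ⟩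
    (x * x⁻¹) * y  ≈⟨ *-cong (*-comm x x⁻¹) refl ⟩
    (x⁻¹ * x) * y  ≈⟨ *-assoc x⁻¹ x y ⟩
    x⁻¹ * (x * y)  ≈⟨ *-cong refl e ⟩
    x⁻¹ * 0#       ≈⟨ zeroʳ x⁻¹ ⟩
    0#             ∎

  *-cancelˡ : ∀ x y z → ¬ (x ≈ 0#) → x * y ≈ x * z → y ≈ z
  *-cancelˡ x y z x≉0 e = begin
    y                ≈⟨ sym (+-identityʳ y) ⟩
    y + 0#           ≈⟨ +-cong refl (sym (-‿inverseˡ z)) ⟩
    y + (- z + z)    ≈⟨ sym (+-assoc _ _ _) ⟩
    (y + - z) + z    ≈⟨ +-cong (*-zero-right x (y + - z) x≉0 difference) refl ⟩
    0# + z           ≈⟨ +-identityˡ z ⟩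
    z                ∎
    where
    difference : x * (y + - z) ≈ 0#
    difference = begin
      x * (y + - z)      ≈⟨ distribˡ x y (- z) ⟩
      x * y + x * - z    ≈⟨ +-cong e (sym (-‿distribʳ-* x z)) ⟩
      x * z + - (x * z)  ≈⟨ -‿inverseʳ _ ⟩
      0#                 ∎

power : ∀ {c ℓ} (K : Field c ℓ) → Field.Carrier K → ℕ → Field.Carrier K
power K α zero = Field.1# K
power K α (suc k) = Field._*_ K α (power K α k)

-- A generator α of the multiplicative group of a field with 1 + Q′ elements
-- has order exactly Q′, by pigeonhole both ways: if α^(k+1) = 1 the Q′ units
-- are among α^0, …, α^k; and two of α^0, …, α^Q′ must coincide.
module GeneratorOrder {c ℓ} (K : Field c ℓ) (Q′ : ℕ) (size : HasSize K (suc Q′)) (α : Field.Carrier K)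
  (α≉0 : ¬ (Field._≈_ K α (Field.0# K)))
  (generates : ∀ β → ¬ (Field._≈_ K β (Field.0# K)) → Σ ℕ λ k → Field._≈_ K β (power K α k)) where
  open Field K hiding (zero)
  open FieldFacts K
  open import Relation.Binary.Reasoning.Setoid setoid
  open import Data.Nat.DivMod using (_%_; _/_; m≡m%n+[m/n]*n; m%n<n)

  pw : ℕ → Carrier
  pw = power K α

  pw-+ : ∀ a b → pw (a ℕ.+ b) ≈ pw a * pw b
  pw-+ zero b = sym (*-identityˡ _)
  pw-+ (suc a) b = trans (*-cong refl (pw-+ a b)) (sym (*-assoc _ _ _))

  pw≉0 : ∀ k → ¬ (pw k ≈ 0#)
  pw≉0 zero = 1≉0
  pw≉0 (suc k) e = pw≉0 k (*-zero-right α (pw k) α≉0 e)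

  pw-multiple : ∀ k → pw k ≈ 1# → ∀ b → pw (b ℕ.* k) ≈ 1#
  pw-multiple k e zero = refl
  pw-multiple k e (suc b) = trans (pw-+ k (b ℕ.* k)) (trans (*-cong e (pw-multiple k e b)) (*-identityˡ 1#))

  pw-mod : ∀ k → pw (suc k) ≈ 1# → ∀ j → pw j ≈ pw (j % suc k)
  pw-mod k e j = begin
    pw j                                       ≡⟨ P.cong pw (m≡m%n+[m/n]*n j (suc k)) ⟩
    pw (j % suc k ℕ.+ (j / suc k) ℕ.* suc k)   ≈⟨ pw-+ (j % suc k) ((j / suc k) ℕ.* suc k) ⟩
    pw (j % suc k) * pw ((j / suc k) ℕ.* suc k) ≈⟨ *-cong refl (pw-multiple (suc k) e (j / suc k)) ⟩
    pw (j % suc k) * 1#                        ≈⟨ *-identityʳ _ ⟩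
    pw (j % suc k)                             ∎

  enum : Fin (suc Q′) → Carrier
  enum = proj₁ size

  onto : ∀ x → Σ (Fin (suc Q′)) λ i → enum i ≈ x
  onto = proj₁ (proj₂ size)

  enum-injective : ∀ i j → enum i ≈ enum j → i ≡ j
  enum-injective = proj₂ (proj₂ size)

  index : Carrier → Fin (suc Q′)
  index x = proj₁ (onto x)

  index0 : Fin (suc Q′)
  index0 = index 0#

  order-lowerBound : ∀ k → pw (suc k) ≈ 1# → Q′ ℕ.≤ suc k
  order-lowerBound k α^k+1≈1 with Q′ ℕ.≤? suc k
  ... | yes le = le
  ... | no nle = ⊥-elim (tooManyUnits (ℕP.≰⇒> nle))
    where
    unit : Fin Q′ → Carrier
    unit t = enum (punchIn index0 t)
    unit≉0 : ∀ t → ¬ (unit t ≈ 0#)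
    unit≉0 t h = FinP.punchInᵢ≢i index0 t (enum-injective _ _ (trans h (sym (proj₂ (onto 0#)))))
    exponent : Fin Q′ → ℕ
    exponent t = proj₁ (generates (unit t) (unit≉0 t))
    unit≈pw : ∀ t → unit t ≈ pw (exponent t)
    unit≈pw t = proj₂ (generates (unit t) (unit≉0 t))
    reduced : Fin Q′ → Fin (suc k)
    reduced t = fromℕ< (m%n<n (exponent t) (suc k))
    tooManyUnits : suc k ℕ.< Q′ → ⊥
    tooManyUnits lt with FinP.pigeonhole lt reduced
    ... | t₁ , t₂ , t₁<t₂ , same = FinP.<⇒≢ t₁<t₂ (FinP.punchIn-injective index0 t₁ t₂ (enum-injective _ _ (begin
      unit t₁                        ≈⟨ unit≈pw t₁ ⟩
      pw (exponent t₁)               ≈⟨ pw-mod k α^k+1≈1 (exponent t₁) ⟩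
      pw (exponent t₁ % suc k)       ≡⟨ P.cong pw (P.trans (P.sym (FinP.toℕ-fromℕ< (m%n<n (exponent t₁) (suc k))))
                                          (P.trans (P.cong toℕ same) (FinP.toℕ-fromℕ< (m%n<n (exponent t₂) (suc k))))) ⟩
      pw (exponent t₂ % suc k)       ≈⟨ sym (pw-mod k α^k+1≈1 (exponent t₂)) ⟩
      pw (exponent t₂)               ≈⟨ sym (unit≈pw t₂) ⟩
      unit t₂                        ∎)))

  pw-notZero : ∀ (t : Fin (suc Q′)) → index0 ≢ index (pw (toℕ t))
  pw-notZero t eq = pw≉0 (toℕ t) (trans (sym (proj₂ (onto (pw (toℕ t)))))
                                         (trans (reflexive (P.cong enum (P.sym eq))) (proj₂ (onto 0#))))

  unitIndex : Fin (suc Q′) → Fin Q′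
  unitIndex t = punchOut (pw-notZero t)

  order-upperBound : Σ ℕ λ e → (pw (suc e) ≈ 1#) × (suc e ℕ.≤ Q′)
  order-upperBound with FinP.pigeonhole (ℕP.n<1+n Q′) unitIndex
  ... | t₁ , t₂ , t₁<t₂ , same = e , *-cancelˡ (pw a) (pw (suc e)) 1# (pw≉0 a) (sym equalPowers) , bound
    where
    a b e : ℕ
    a = toℕ t₁
    b = toℕ t₂
    e = b ∸ suc a
    a+1+e≡b : a ℕ.+ suc e ≡ b
    a+1+e≡b = P.trans (ℕP.+-suc a e) (ℕP.m+[n∸m]≡n t₁<t₂)
    sameIndex : index (pw a) ≡ index (pw b)
    sameIndex = FinP.punchOut-injective (pw-notZero t₁) (pw-notZero t₂) same
    equalPowers : pw a * 1# ≈ pw a * pw (suc e)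
    equalPowers = begin
      pw a * 1#            ≈⟨ *-identityʳ _ ⟩
      pw a                 ≈⟨ sym (proj₂ (onto (pw a))) ⟩
      enum (index (pw a))  ≡⟨ P.cong enum sameIndex ⟩
      enum (index (pw b))  ≈⟨ proj₂ (onto (pw b)) ⟩
      pw b                 ≡⟨ P.cong pw (P.sym a+1+e≡b) ⟩
      pw (a ℕ.+ suc e)     ≈⟨ pw-+ a (suc e) ⟩
      pw a * pw (suc e)    ∎
    bound : suc e ℕ.≤ Q′
    bound = ℕP.≤-trans (P.subst (suc e ℕ.≤_) a+1+e≡b (ℕP.m≤n+m (suc e) a)) (ℕP.≤-pred (FinP.toℕ<n t₂))

  generator-order : pw Q′ ≈ 1#
  generator-order with order-upperBound
  ... | e , α^e+1≈1 , le = P.subst (λ t → pw t ≈ 1#) (ℕP.≤-antisym le (order-lowerBound e α^e+1≈1)) α^e+1≈1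

  generator-order-minimal : ∀ k → 1 ℕ.≤ k → k ℕ.< Q′ → ¬ (pw k ≈ 1#)
  generator-order-minimal (suc k) _ lt α^k≈1 = ℕP.<⇒≱ lt (order-lowerBound k α^k≈1)

module FieldHomFacts {c ℓ} {F K : Field c ℓ} (φ : FieldHom F K) where
  private
    module F = Field F
    module K = Field K
    module FS = RingSums F.commutativeRing
    module KS = RingSums K.commutativeRing
  open FieldHom φ
  open import Algebra.Properties.Ring K.ring using (x+x≈x⇒x≈0; +-inverseˡ-unique)

  ι-0 : ι F.0# K.≈ K.0#
  ι-0 = x+x≈x⇒x≈0 (ι F.0#) (K.trans (K.sym (ι-+ F.0# F.0#)) (ι-cong (F.+-identityˡ F.0#)))

  ι-neg : ∀ x → ι (F.- x) K.≈ K.- (ι x)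
  ι-neg x = +-inverseˡ-unique (ι (F.- x)) (ι x)
    (K.trans (K.sym (ι-+ (F.- x) x)) (K.trans (ι-cong (F.-‿inverseˡ x)) ι-0))

  ι-Σ : ∀ k (g : Fin k → F.Carrier) → ι (FS.Σ-fin k g) K.≈ KS.Σ-fin k (λ i → ι (g i))
  ι-Σ zero g = ι-0
  ι-Σ (suc k) g = K.trans (ι-+ _ _) (K.+-cong K.refl (ι-Σ k (λ i → g (suc i))))

module SingerCycle {c ℓ} (F K : Field c ℓ) (φ : FieldHom F K) (m' n' : ℕ) (f : Over.Pol F)
  (α : Field.Carrier K) (α≉0 : ¬ (Field._≈_ K α (Field.0# K)))
  (≈-dec : ∀ x y → Dec (Field._≈_ F x y))
  (monic : Over.Monic F (suc m' ℕ.* suc n') f)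
  (root : Field._≈_ K (Over.evalUpTo F K φ (suc m' ℕ.* suc n') f α) (Field.0# K))
  (minimal : ∀ g dg → Over.HasDegree F dg g → Field._≈_ K (Over.evalUpTo F K φ dg g α) (Field.0# K) →
               suc m' ℕ.* suc n' ℕ.≤ dg)
  where
  open Field F hiding (zero)
  open Over F using (Pol; _^ₘ_; Iₘ; _≈ₘ_; evalUpTo; powK; HasDegree; charPoly)
  open BlockCompanion F (suc m') n'
  open Companion F using (companion; charPoly-coeff-0)
  import Relation.Binary.Reasoning.Setoid
  private
    module K = Field K
    module KS = RingSums K.commutativeRing
    module FD = Determinant commutativeRing
    module KR = Relation.Binary.Reasoning.Setoid K.setoid
  open FieldHom φ
  open FieldHomFacts φ

  d : ℕ
  d = suc m' ℕ.* suc n'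

  T : Over.Mat F N
  T = blockCompanionOf f

  pw : ℕ → K.Carrier
  pw = power K α

  powK≡pw : ∀ k → powK K φ α k ≡ pw k
  powK≡pw zero = P.refl
  powK≡pw (suc k) = P.cong (α K.*_) (powK≡pw k)

  evalUpTo-Σℕ : ∀ e g → evalUpTo K φ e g α K.≈ KS.Σℕ (suc e) (λ t → ι (g t) K.* pw t)
  evalUpTo-Σℕ e g = K.trans (K.reflexive (KS.Σ-fin≡Σℕ (suc e) (λ t → ι (g t) K.* powK K φ α t)))
                            (KS.Σℕ-cong (suc e) {g = λ t → ι (g t) K.* pw t} (λ t _ → K.*-cong K.refl (K.reflexive (powK≡pw t))))

  term : ℕ → K.Carrier
  term t = ι (f t) K.* pw t

  -- f(α) = 0 with f monic of degree N: the lower terms sum to −α^N.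
  lowerTerms : KS.Σℕ N term K.≈ K.- pw N
  lowerTerms = P.subst (λ t → KS.Σℕ t term K.≈ K.- pw t) m*n≡N
    (KS.+-inverseˡ-unique (KS.Σℕ d term) (pw d)
      (K.trans (K.+-cong K.refl (K.sym leading)) (K.trans (K.sym (KS.Σℕ-last d term)) (K.trans (K.sym (evalUpTo-Σℕ d f)) root))))
    where
    leading : term d K.≈ pw d
    leading = K.trans (K.*-cong (K.trans (ι-cong (proj₁ monic)) ι-1) K.refl) (K.*-identityˡ _)

  -- (1, α, …, α^{N-1}) is a left eigenvector of the companion matrix of f
  -- with eigenvalue α: column s < N − 1 gives α^{s+1}, the last column gives
  -- −Σ f_t α^t = α^N.
  companion-column : ∀ (s : Fin N) → KS.Σ-fin N (λ j → ι (companion f N j s) K.* pw (toℕ j)) K.≈ α K.* pw (toℕ s)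
  companion-column s with toℕ s ℕ.≟ N ∸ 1
  ... | yes s≡last = KR.begin
    KS.Σ-fin N (λ j → ι (companion f N j s) K.* pw (toℕ j)) KR.≈⟨ KS.Σ-cong N lastColumn ⟩
    KS.Σ-fin N (λ j → K.- term (toℕ j))                      KR.≈⟨ K.sym (KS.Σ-neg N (λ j → term (toℕ j))) ⟩
    K.- KS.Σ-fin N (λ j → term (toℕ j))                      KR.≡⟨ P.cong K.-_ (KS.Σ-fin≡Σℕ N term) ⟩
    K.- KS.Σℕ N term                                          KR.≈⟨ K.-‿cong lowerTerms ⟩
    K.- (K.- pw N)                                            KR.≈⟨ KS.-‿involutive _ ⟩
    pw N                                                      KR.≡⟨ P.cong (λ t → α K.* pw t) (P.sym s≡last) ⟩
    α K.* pw (toℕ s)                                          KR.∎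
    where
    lastColumn : ∀ j → ι (companion f N j s) K.* pw (toℕ j) K.≈ K.- term (toℕ j)
    lastColumn j = K.trans (K.*-cong (K.trans (ι-cong (reflexive entry)) (ι-neg (f (toℕ j)))) K.refl)
                           (K.sym (KS.-‿distribˡ-* (ι (f (toℕ j))) (pw (toℕ j))))
      where
      entry : companion f N j s ≡ - f (toℕ j)
      entry = if-yes (toℕ s ℕ.≟ N ∸ 1) s≡last
  ... | no s≢last = K.trans (KS.Σ-single (N ∸ 1) column s+1 others) atNext
    where
    column : Fin N → K.Carrier
    column j = ι (companion f N j s) K.* pw (toℕ j)
    1+s<N : suc (toℕ s) ℕ.< N
    1+s<N = ℕ.s≤s (ℕP.≤∧≢⇒< (ℕP.≤-pred (FinP.toℕ<n s)) s≢last)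
    s+1 : Fin N
    s+1 = fromℕ< 1+s<N
    entry : ∀ j → companion f N j s ≡ (if does (toℕ j ℕ.≟ suc (toℕ s)) then 1# else 0#)
    entry j = if-no (toℕ s ℕ.≟ N ∸ 1) s≢last
    atNext : column s+1 K.≈ α K.* pw (toℕ s)
    atNext = K.trans (K.*-cong (K.trans (ι-cong (reflexive (P.trans (entry s+1) (if-yes (toℕ s+1 ℕ.≟ suc (toℕ s)) (FinP.toℕ-fromℕ< 1+s<N)))))
                                        ι-1)
                               (K.reflexive (P.cong pw (FinP.toℕ-fromℕ< 1+s<N))))
                     (K.*-identityˡ _)
    others : ∀ j → j ≢ s+1 → column j K.≈ K.0#
    others j j≢s+1 = K.trans (K.*-cong (K.trans (ι-cong (reflexive (P.trans (entry j) (if-no (toℕ j ℕ.≟ suc (toℕ s)) j≠s+1)))) ι-0)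
                                       K.refl)
                             (K.zeroˡ _)
      where
      j≠s+1 : toℕ j ≢ suc (toℕ s)
      j≠s+1 e = j≢s+1 (FinP.toℕ-injective (P.trans e (P.sym (FinP.toℕ-fromℕ< 1+s<N))))

  -- Φ v = Σ_k v_k α^(σ k): evaluation at α of the polynomial with
  -- coefficient v_k at X^(σ k).
  weight : Fin N → K.Carrier
  weight k = pw (toℕ (σ k))

  Φ : (Fin N → Carrier) → K.Carrier
  Φ v = KS.Σ-fin N (λ k → ι (v k) K.* weight k)

  Φ-cong : ∀ {u w : Fin N → Carrier} → (∀ i → u i ≈ w i) → Φ u K.≈ Φ w
  Φ-cong e = KS.Σ-cong N (λ k → K.*-cong (ι-cong (e k)) (K.refl {weight k}))

  T-column : ∀ l → KS.Σ-fin N (λ k → ι (T k l) K.* weight k) K.≈ α K.* weight l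
  T-column l = K.trans (K.sym (KS.Σ-permute N (λ j → ι (companion f N j (σ l)) K.* pw (toℕ j)) σ-perm))
                       (companion-column (σ l))

  Φ-T : ∀ v → Φ (λ i → FD.Σ-fin N (λ j → T i j * v j)) K.≈ α K.* Φ v
  Φ-T v = KR.begin
    KS.Σ-fin N (λ i → ι (FD.Σ-fin N (λ j → T i j * v j)) K.* weight i)
      KR.≈⟨ KS.Σ-cong N (λ i → K.*-cong (K.trans (ι-Σ N (λ j → T i j * v j)) (KS.Σ-cong N (λ j → ι-* (T i j) (v j))))
                                         (K.refl {weight i})) ⟩
    KS.Σ-fin N (λ i → KS.Σ-fin N (λ j → ι (T i j) K.* ι (v j)) K.* weight i)
      KR.≈⟨ KS.Σ-cong N (λ i → KS.Σ-*ʳ N (weight i) (λ j → ι (T i j) K.* ι (v j))) ⟩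
    KS.Σ-fin N (λ i → KS.Σ-fin N (λ j → (ι (T i j) K.* ι (v j)) K.* weight i))
      KR.≈⟨ KS.Σ-comm N N (λ i j → (ι (T i j) K.* ι (v j)) K.* weight i) ⟩
    KS.Σ-fin N (λ j → KS.Σ-fin N (λ i → (ι (T i j) K.* ι (v j)) K.* weight i))
      KR.≈⟨ KS.Σ-cong N (λ j → K.trans (KS.Σ-cong N (λ i → xy*z≈y*xz (ι (T i j)) (ι (v j)) (weight i)))
                                        (K.sym (KS.Σ-*ˡ N (ι (v j)) (λ i → ι (T i j) K.* weight i)))) ⟩
    KS.Σ-fin N (λ j → ι (v j) K.* KS.Σ-fin N (λ i → ι (T i j) K.* weight i))
      KR.≈⟨ KS.Σ-cong N (λ j → K.trans (K.*-cong K.refl (T-column j)) (y*az≈a*yz (ι (v j)) α (weight j))) ⟩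
    KS.Σ-fin N (λ j → α K.* (ι (v j) K.* weight j))
      KR.≈⟨ K.sym (KS.Σ-*ˡ N α (λ j → ι (v j) K.* weight j)) ⟩
    α K.* Φ v KR.∎
    where
    xy*z≈y*xz : ∀ x y z → (x K.* y) K.* z K.≈ y K.* (x K.* z)
    xy*z≈y*xz x y z = K.trans (K.*-cong (K.*-comm x y) K.refl) (K.*-assoc y x z)
    y*az≈a*yz : ∀ y a z → y K.* (a K.* z) K.≈ a K.* (y K.* z)
    y*az≈a*yz y a z = K.trans (K.sym (K.*-assoc y a z)) (xy*z≈y*xz y a z)

  Φ-power-column : ∀ k l → Φ (λ i → (T ^ₘ k) i l) K.≈ pw k K.* weight l
  Φ-power-column zero l =
    K.trans (KS.Σ-single (N ∸ 1) entry l others) (K.*-cong (K.trans (ι-cong (reflexive (if-yes (l Fin.≟ l) P.refl))) ι-1) K.refl)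
    where
    entry : Fin N → K.Carrier
    entry i = ι (Iₘ i l) K.* weight i
    others : ∀ i → i ≢ l → entry i K.≈ K.0#
    others i i≢l = K.trans (K.*-cong (K.trans (ι-cong (reflexive (if-no (i Fin.≟ l) i≢l))) ι-0) K.refl) (K.zeroˡ _)
  Φ-power-column (suc k) l =
    K.trans (Φ-T (λ j → (T ^ₘ k) j l)) (K.trans (K.*-cong K.refl (Φ-power-column k l)) (K.sym (K.*-assoc _ _ _)))

  -- Φ has trivial kernel: a nonzero v gives the nonzero polynomial g with
  -- coefficients v ∘ σ⁻¹, of degree < N = deg f, and g(α) = Φ v.
  module Kernel (v : Fin N → Carrier) (Φv≈0 : Φ v K.≈ K.0#) where
    g : Pol
    g t with t ℕ.<? N
    ... | yes t<N = v (σ⁻¹ (fromℕ< t<N))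
    ... | no _ = 0#

    g-below : ∀ t (t<N : t ℕ.< N) → g t ≡ v (σ⁻¹ (fromℕ< t<N))
    g-below t t<N with t ℕ.<? N
    ... | yes _ = P.refl
    ... | no t≮N = ⊥-elim (t≮N t<N)

    g-above : ∀ t → ¬ (t ℕ.< N) → g t ≡ 0#
    g-above t t≮N with t ℕ.<? N
    ... | yes t<N = ⊥-elim (t≮N t<N)
    ... | no _ = P.refl

    g-σ : ∀ i → g (toℕ (σ i)) ≡ v i
    g-σ i = P.trans (g-below _ (FinP.toℕ<n (σ i)))
                    (P.trans (P.cong (v ∘ σ⁻¹) (FinP.fromℕ<-toℕ (σ i) (FinP.toℕ<n (σ i)))) (P.cong v (σ⁻¹-σ i)))

    gTerm : ℕ → K.Carrier
    gTerm t = ι (g t) K.* pw t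

    Φ≈g[α] : Φ v K.≈ KS.Σℕ N gTerm
    Φ≈g[α] = KR.begin
      Φ v                                    KR.≈⟨ KS.Σ-cong N (λ k → K.*-cong (ι-cong (reflexive (P.sym (g-σ k)))) (K.refl {weight k})) ⟩
      KS.Σ-fin N (λ k → gTerm (toℕ (σ k)))   KR.≈⟨ K.sym (KS.Σ-permute N (λ j → gTerm (toℕ j)) σ-perm) ⟩
      KS.Σ-fin N (λ j → gTerm (toℕ j))       KR.≡⟨ KS.Σ-fin≡Σℕ N gTerm ⟩
      KS.Σℕ N gTerm                          KR.∎

    -- If g has a nonzero coefficient, its degree dg < N contradicts minimality.
    g-nonzero-impossible : ∀ t → t ℕ.< N → ¬ (g t ≈ 0#) → ⊥
    g-nonzero-impossible t t<N g[t]≉0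
      with largestWitness N (λ t → ¬ (g t ≈ 0#)) nonzero? t t<N g[t]≉0
      where
      nonzero? : ∀ t → Dec (¬ (g t ≈ 0#))
      nonzero? t with ≈-dec (g t) 0#
      ... | yes e = no (λ k → k e)
      ... | no k = yes k
    ... | dg , dg<N , g[dg]≉0 , zeroBetween =
      ℕP.<-irrefl P.refl (ℕP.<-≤-trans (P.subst (dg ℕ.<_) (P.sym m*n≡N) dg<N) (minimal g dg (g[dg]≉0 , zeroAbove) g[α]≈0))
      where
      zeroAbove : ∀ t → dg ℕ.< t → g t ≈ 0#
      zeroAbove t dg<t = byCases (t ℕ.<? N) (≈-dec (g t) 0#)
        where
        byCases : Dec (t ℕ.< N) → Dec (g t ≈ 0#) → g t ≈ 0#
        byCases (no t≮N) _ = reflexive (g-above t t≮N)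
        byCases (yes _) (yes e) = e
        byCases (yes t<N) (no k) = ⊥-elim (zeroBetween t dg<t t<N k)
      g[α]≈0 : evalUpTo K φ dg g α K.≈ K.0#
      g[α]≈0 = KR.begin
        evalUpTo K φ dg g α            KR.≈⟨ evalUpTo-Σℕ dg g ⟩
        KS.Σℕ (suc dg) gTerm           KR.≈⟨ KS.Σℕ-extend (suc dg) (N ∸ suc dg) gTerm
                                               (λ t le _ → K.trans (K.*-cong (K.trans (ι-cong (zeroAbove t le)) ι-0) K.refl) (K.zeroˡ _)) ⟩
        KS.Σℕ (suc dg ℕ.+ (N ∸ suc dg)) gTerm KR.≡⟨ P.cong (λ t → KS.Σℕ t gTerm) (ℕP.m+[n∸m]≡n dg<N) ⟩
        KS.Σℕ N gTerm                  KR.≈⟨ K.sym Φ≈g[α] ⟩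
        Φ v                            KR.≈⟨ Φv≈0 ⟩
        K.0#                           KR.∎

  Φ-kernel : ∀ v → Φ v K.≈ K.0# → ∀ i → v i ≈ 0#
  Φ-kernel v Φv≈0 i with ≈-dec (v i) 0#
  ... | yes e = e
  ... | no v[i]≉0 = ⊥-elim (Kernel.g-nonzero-impossible v Φv≈0 (toℕ (σ i)) (FinP.toℕ<n (σ i))
                              (λ e → v[i]≉0 (trans (reflexive (P.sym (Kernel.g-σ v Φv≈0 i))) e)))

  Φ-difference : ∀ u w → Φ (λ i → u i + - w i) K.≈ Φ u K.+ K.- Φ w
  Φ-difference u w = KR.begin
    KS.Σ-fin N (λ i → ι (u i + - w i) K.* weight i)
      KR.≈⟨ KS.Σ-cong N (λ i → K.trans (K.*-cong (K.trans (ι-+ (u i) (- w i)) (K.+-cong K.refl (ι-neg (w i)))) K.refl)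
              (K.trans (K.distribʳ (weight i) (ι (u i)) (K.- ι (w i))) (K.+-cong K.refl (K.sym (KS.-‿distribˡ-* (ι (w i)) (weight i)))))) ⟩
    KS.Σ-fin N (λ i → ι (u i) K.* weight i K.+ K.- (ι (w i) K.* weight i))
      KR.≈⟨ KS.Σ-+ N (λ i → ι (u i) K.* weight i) (λ i → K.- (ι (w i) K.* weight i)) ⟩
    Φ u K.+ KS.Σ-fin N (λ i → K.- (ι (w i) K.* weight i))
      KR.≈⟨ K.+-cong K.refl (K.sym (KS.Σ-neg N (λ i → ι (w i) K.* weight i))) ⟩
    Φ u K.+ K.- Φ w KR.∎

  Φ-injective : ∀ u w → Φ u K.≈ Φ w → ∀ i → u i ≈ w i
  Φ-injective u w e i = trans (FD.+-inverseˡ-unique (u i) (- w i) (Φ-kernel (λ i → u i + - w i) Φ[u-w]≈0 i)) (FD.-‿involutive (w i))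
    where
    Φ[u-w]≈0 : Φ (λ i → u i + - w i) K.≈ K.0#
    Φ[u-w]≈0 = K.trans (Φ-difference u w) (K.trans (K.+-cong e K.refl) (K.-‿inverseʳ (Φ w)))

  unitColumn : Fin N
  unitColumn = σ⁻¹ zero

  weight-unitColumn : weight unitColumn ≡ K.1#
  weight-unitColumn = P.cong (λ t → pw (toℕ t)) (σ-σ⁻¹ zero)

  T^k≈I⇒α^k≈1 : ∀ k → (T ^ₘ k) ≈ₘ Iₘ → pw k K.≈ K.1#
  T^k≈I⇒α^k≈1 k e = KR.begin
    pw k                                 KR.≈⟨ K.sym (K.*-identityʳ _) ⟩
    pw k K.* K.1#                        KR.≡⟨ P.cong (pw k K.*_) (P.sym weight-unitColumn) ⟩
    pw k K.* weight unitColumn           KR.≈⟨ K.sym (Φ-power-column k unitColumn) ⟩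
    Φ (λ i → (T ^ₘ k) i unitColumn)      KR.≈⟨ Φ-cong (λ i → e i unitColumn) ⟩
    Φ (λ i → Iₘ i unitColumn)            KR.≈⟨ Φ-power-column zero unitColumn ⟩
    K.1# K.* weight unitColumn           KR.≡⟨ P.cong (K.1# K.*_) weight-unitColumn ⟩
    K.1# K.* K.1#                        KR.≈⟨ K.*-identityˡ _ ⟩
    K.1#                                 KR.∎

  α^k≈1⇒T^k≈I : ∀ k → pw k K.≈ K.1# → (T ^ₘ k) ≈ₘ Iₘ
  α^k≈1⇒T^k≈I k e i l = Φ-injective (λ i → (T ^ₘ k) i l) (λ i → Iₘ i l)
    (K.trans (Φ-power-column k l) (K.trans (K.*-cong e K.refl) (K.sym (Φ-power-column zero l)))) i

  -- f(0) ≠ 0: otherwise f = X·g with g(α) = 0 (as α ≠ 0) and deg g < deg f.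
  f[0]≉0 : ¬ (f 0 ≈ 0#)
  f[0]≉0 f[0]≈0 = ℕP.<-irrefl P.refl (minimal g d′ deg-g g[α]≈0)
    where
    d′ : ℕ
    d′ = n' ℕ.+ m' ℕ.* suc n'
    g : Pol
    g t = f (suc t)
    deg-g : HasDegree d′ g
    deg-g = (λ e → 1≉0 (trans (sym (proj₁ monic)) e)) , (λ k lt → proj₂ monic (suc k) (ℕ.s≤s lt))
    α*g[α]≈0 : α K.* evalUpTo K φ d′ g α K.≈ K.0#
    α*g[α]≈0 = KR.begin
      α K.* evalUpTo K φ d′ g α                      KR.≈⟨ K.*-cong K.refl (evalUpTo-Σℕ d′ g) ⟩
      α K.* KS.Σℕ d (λ t → ι (g t) K.* pw t)         KR.≈⟨ KS.Σℕ-*ˡ d α (λ t → ι (g t) K.* pw t) ⟩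
      KS.Σℕ d (λ t → α K.* (ι (g t) K.* pw t))       KR.≈⟨ KS.Σℕ-cong d {g = λ t → term (suc t)} (λ t _ → K.trans (K.sym (K.*-assoc _ _ _))
                                                           (K.trans (K.*-cong (K.*-comm α _) K.refl) (K.*-assoc _ _ _))) ⟩
      KS.Σℕ d (λ t → term (suc t))                   KR.≈⟨ K.sym (K.+-identityˡ _) ⟩
      K.0# K.+ KS.Σℕ d (λ t → term (suc t))          KR.≈⟨ K.+-cong (K.sym (K.trans (K.*-cong (K.trans (ι-cong f[0]≈0) ι-0) K.refl) (K.zeroˡ _))) K.refl ⟩
      KS.Σℕ (suc d) term                             KR.≈⟨ K.sym (evalUpTo-Σℕ d f) ⟩
      evalUpTo K φ d f α                             KR.≈⟨ root ⟩
      K.0#                                           KR.∎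
    g[α]≈0 : evalUpTo K φ d′ g α K.≈ K.0#
    g[α]≈0 = FieldFacts.*-zero-right K α _ α≉0 α*g[α]≈0

  -- det T = ±f(0) ≠ 0, since f is the characteristic polynomial of T.
  T-nonsingular : ¬ (FD.det N T ≈ 0#)
  T-nonsingular det≈0 = f[0]≉0 (begin
    f 0                        ≈⟨ sym (charPoly-blockCompanion-monic f monic 0) ⟩
    charPoly T 0               ≈⟨ charPoly-coeff-0 N T ⟩
    FD.altSign N (FD.det N T)  ≈⟨ FD.alt-cong N det≈0 ⟩
    FD.altSign N 0#            ≈⟨ FD.alt-0 N ⟩
    0#                         ∎)
    where open Relation.Binary.Reasoning.Setoid setoid

-- The notation of the statement; imported only here, since the modules above
-- use _*_ for ring multiplication.
open import Data.Nat using (_*_; _≤_)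

size-pred : ∀ {c ℓ} (K : Field c ℓ) Q → HasSize K Q → Q ≡ suc (Q ∸ 1)
size-pred K zero (_ , onto , _) with onto (Field.0# K)
... | () , _
size-pred K (suc Q) _ = P.refl


-- The clauses for m = 0 or n = 0 are absurd by 1 ≤ m, 1 ≤ n.  Both parts use
-- T = blockCompanionOf f; the primitive case adds its invertibility and order.
proposition2p2 : ∀ {c ℓ} (q : ℕ) → IsPrimePower q → (F : Field c ℓ) → HasSize F q →
    (m n : ℕ) → 1 ≤ m → 1 ≤ n →
    ((f : Over.Pol F) → Over.Monic F (m * n) f → Over.Irreducible F f →
       Σ (Over.Mat F (n * m)) λ T →
         Over.IsBlockCompanion F m n T × Over._≈ₚ_ F (Over.charPoly F T) f)
    ×
    ((f : Over.Pol F) → Over.IsPrimitive F q (m * n) f →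
       Σ (Over.Mat F (n * m)) λ T →
         Over.IsBlockCompanionSinger F q m n T × Over._≈ₚ_ F (Over.charPoly F T) f)
proposition2p2 q _ F sizeF (suc m') (suc n') _ _ = irreducibleCase , primitiveCase
  where
  open Over F
  open BlockCompanion F (suc m') n'
  m : ℕ
  m = suc m'

  irreducibleCase : (f : Pol) → Monic (m * n) f → Irreducible f →
    Σ (Mat N) λ T → IsBlockCompanion m n T × (charPoly T ≈ₚ f)
  irreducibleCase f monic _ =
    blockCompanionOf f , blockCompanionOf-isBlockCompanion f , charPoly-blockCompanion-monic f monic

  primitiveCase : (f : Pol) → IsPrimitive q (m * n) f →
    Σ (Mat N) λ T → IsBlockCompanionSinger q m n T × (charPoly T ≈ₚ f)
  primitiveCase f (_ , K , φ , sizeK , α , α≉0 , generates , monic , root , minimal) =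
    blockCompanionOf f , (blockCompanionOf-isBlockCompanion f , S.T-nonsingular , order) , charPoly-blockCompanion-monic f monic
    where
    module S = SingerCycle F K φ m' n' f α α≉0 (FieldFacts.≈-dec F sizeF) monic root minimal
    Q : ℕ
    Q = q ℕ.^ (m * n)
    generates′ : ∀ β → ¬ (Field._≈_ K β (Field.0# K)) → Σ ℕ λ k → Field._≈_ K β (power K α k)
    generates′ β β≉0 with generates β β≉0
    ... | k , β≈α^k = k , Field.trans K β≈α^k (Field.reflexive K (S.powK≡pw k))
    module O = GeneratorOrder K (Q ∸ 1) (P.subst (HasSize K) (size-pred K Q sizeK) sizeK) α α≉0 generates′
    order : HasOrder (blockCompanionOf f) (Q ∸ 1)
    order = S.α^k≈1⇒T^k≈I (Q ∸ 1) O.generator-order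
          , λ k 1≤k k<Q-1 T^k≈I → O.generator-order-minimal k 1≤k k<Q-1 (S.T^k≈I⇒α^k≈1 k T^k≈I)
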